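{- Let $(A,B)$ be an invertible Jones pair of $n\times n$ matrices with $A$ symmetric, let $d^2=n$, and let \[ V=\begin{pmatrix} dA & -dA & B^{(-)} & B^{(-)}\\ -dA & dA & B^{(-)} & B^{(-)}\\ (B^{(-)})^T & (B^{(-)})^T & dA & -dA\\ (B^{(-)})^T & (B^{(-)})^T & -dA & dA \end{pmatrix}. \] Let $M\in\mathcal B=\{\mathcal M(F,G,H) : F\in\mathcal N_A,\ G,H\in\mathcal N_{A,B}\}$. Then for all $r,s\in\{2n+1,\dots,4n\}$, the vector $Ve_r\circ V^{(-)}e_s\in\mathbb C^{4n}$ is an eigenvector of $M$ (here $e_1,\dots,e_{4n}$ is the standard basis of $\mathbb C^{4n}$).
   Context: All matrices are complex. $X\circ Y$ is the Schur product; $X^{(-)}$ is the Schur inverse of a matrix with no zero entries. $W$ ($n\times n$) is type-II if $W(W^{(-)})^T=nI$. For a matrix $C$, $X_C(M)=CM$, $\Delta_C(M)=C\circ M$. A Jones pair is a pair $(A,B)$ of $n\times n$ matrices with $X_A$, $\Delta_B$ invertible, $X_A\Delta_BX_A=\Delta_BX_A\Delta_B$ and $X_A\Delta_{B^T}X_A=\Delta_{B^T}X_A\Delta_{B^T}$; it is invertible if moreover $A$ has no zero entry and $B$ is invertible (equivalently $A,B$ type-II). With $e_1,\dots,e_n$ the standard basis of $\mathbb C^n$, for $P$ invertible and $Q$ without zero entries, $\mathcal N_{P,Q}$ is the set of matrices $M$ such that every $Pe_i\circ Qe_j$ is an eigenvector of $M$, and $\Theta_{P,Q}(M)$ is the matrix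 with $M(Pe_i\circ Qe_j)=\Theta_{P,Q}(M)_{ij}(Pe_i\circ Qe_j)$. For type-II $P$, $\mathcal N_P:=\mathcal N_{P,P^{(-)}}$, $\Theta_P:=\Theta_{P,P^{(-)}}$. Standing facts for the definitions: $\mathcal N_{A,B}=\mathcal N_{A,B^T}$ is closed under transposition and $\mathcal N_A=\mathcal N_{B^{(-)}}$. Pairing: for $H\in\mathcal N_{A,B}$, the matrix paired with $H$ is the unique $K$ with $K^T\in\mathcal N_{A,B^T}$ and $\Theta_{A,B}(H)=\Theta_{A,B^T}(K^T)^T$. For $F\in\mathcal N_A$, $G,H\in\mathcal N_{A,B}$, with $K$ paired with $H$, \[ \mathcal M(F,G,H)=\begin{pmatrix} \Theta_A(F)+H & \Theta_A(F)-H & \Theta_{A,B}(G) & \Theta_{A,B}(G)\\ \Theta_A(F)-H & \Theta_A(F)+H & \Theta_{A,B}(G) & \Theta_{A,B}(G)\\ \Theta_{A,B}(G^T)^T & \Theta_{A,B}(G^T)^T & \Theta_{B^{(-)}}(F)+K & \Theta_{B^{(-)}}(F)-K\\ \Theta_{A,B}(G^T)^T & \Theta_{A,B}(G^T)^T & \Theta_{B^{(-)}}(F)-K & \Theta_{B^{(-)}}(F)+K \end{pmatrix}. \] -}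

module Defs where

open import Level using (Level; _⊔_)
open import Data.Nat as ℕ using (ℕ; zero; suc)
open import Data.Fin using (Fin; zero; suc; remQuot)
open import Data.Product using (Σ; ∃; _×_; _,_; proj₁; proj₂)
open import Data.List using (List; []; _∷_)
open import Relation.Nullary using (¬_)
open import Algebra.Bundles using (CommutativeRing)

module RingAux {c ℓ} (R : CommutativeRing c ℓ) where
  open CommutativeRing R hiding (zero)

  fromℕ : ℕ → Carrier
  fromℕ zero    = 0#
  fromℕ (suc m) = 1# + fromℕ m

  evalPoly : List Carrier → Carrier → Carrier
  evalPoly []       x = 0#
  evalPoly (a ∷ as) x = a + x * evalPoly as x

-- An algebraically closed field of characteristic zero (the complex
-- numbers are the intended model).  The inverse is a total
-- function, whose value at 0 is irrelevant.
record ACF0 (c ℓ : Level) : Set (Level.suc (c ⊔ ℓ)) where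
  field
    cring : CommutativeRing c ℓ
  open CommutativeRing cring public hiding (zero)
  open RingAux cring public
  field
    _⁻¹        : Carrier → Carrier
    ⁻¹-inverse : ∀ x → ¬ (x ≈ 0#) → x * (x ⁻¹) ≈ 1#
    0≉1        : ¬ (0# ≈ 1#)
    char0      : ∀ m → ¬ (fromℕ (suc m) ≈ 0#)
    -- every monic polynomial of degree ≥ 1 has a root
    algClosed  : ∀ (as : List Carrier) (a : Carrier) →
                 ∃ λ x → evalPoly (a ∷ (as Data.List.++ (1# ∷ []))) x ≈ 0#

module Matrices {c ℓ} (𝔽 : ACF0 c ℓ) where
  open ACF0 𝔽

  Vector : ℕ → Set c
  Vector n = Fin n → Carrier

  Matrix : ℕ → Set c
  Matrix n = Fin n → Fin n → Carrier

  Σ[_] : ∀ {n} → (Fin n → Carrier) → Carrier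
  Σ[_] {zero}  f = 0#
  Σ[_] {suc n} f = f zero + Σ[_] (λ i → f (suc i))

  _≈ᵥ_ : ∀ {n} → Vector n → Vector n → Set ℓ
  u ≈ᵥ v = ∀ i → u i ≈ v i

  _≈ₘ_ : ∀ {n} → Matrix n → Matrix n → Set ℓ
  X ≈ₘ Y = ∀ i j → X i j ≈ Y i j

  _⊗_ : ∀ {n} → Matrix n → Matrix n → Matrix n
  (X ⊗ Y) i j = Σ[ (λ k → X i k * Y k j) ]

  _·ᵥ_ : ∀ {n} → Matrix n → Vector n → Vector n
  (X ·ᵥ v) i = Σ[ (λ k → X i k * v k) ]

  _∙ᵥ_ : ∀ {n} → Carrier → Vector n → Vector n
  (a ∙ᵥ v) i = a * v i

  _∙ₘ_ : ∀ {n} → Carrier → Matrix n → Matrix n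
  (a ∙ₘ X) i j = a * X i j

  -ₘ_ : ∀ {n} → Matrix n → Matrix n
  (-ₘ X) i j = - (X i j)

  _+ₘ_ : ∀ {n} → Matrix n → Matrix n → Matrix n
  (X +ₘ Y) i j = X i j + Y i j

  _-ₘ_ : ∀ {n} → Matrix n → Matrix n → Matrix n
  X -ₘ Y = X +ₘ (-ₘ Y)

  I : ∀ {n} → Matrix n
  I i j with Data.Fin._≟_ i j
  ... | Relation.Nullary.yes _ = 1#
  ... | Relation.Nullary.no  _ = 0#

  _ᵀ : ∀ {n} → Matrix n → Matrix n
  (X ᵀ) i j = X j i

  _∘ₘ_ : ∀ {n} → Matrix n → Matrix n → Matrix n
  (X ∘ₘ Y) i j = X i j * Y i j

  _∘ᵥ_ : ∀ {n} → Vector n → Vector n → Vector n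
  (u ∘ᵥ v) i = u i * v i

  _⁽⁻⁾ : ∀ {n} → Matrix n → Matrix n
  (X ⁽⁻⁾) i j = (X i j) ⁻¹

  col : ∀ {n} → Matrix n → Fin n → Vector n
  col X i k = X k i

  NoZeroEntry : ∀ {n} → Matrix n → Set ℓ
  NoZeroEntry X = ∀ i j → ¬ (X i j ≈ 0#)

  Invertible : ∀ {n} → Matrix n → Set (c ⊔ ℓ)
  Invertible X = ∃ λ Y → ((X ⊗ Y) ≈ₘ I) × ((Y ⊗ X) ≈ₘ I)

  Symmetric : ∀ {n} → Matrix n → Set ℓ
  Symmetric X = (X ᵀ) ≈ₘ X

  TypeII : ∀ {n} → Matrix n → Set ℓ
  TypeII {n} W = NoZeroEntry W × ((W ⊗ ((W ⁽⁻⁾) ᵀ)) ≈ₘ (fromℕ n ∙ₘ I))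

  -- Jones pair: X_A, Δ_B invertible (i.e. A invertible, B without zero entries),
  -- X_A Δ_B X_A = Δ_B X_A Δ_B and the same with Bᵀ, as maps on matrices.
  JonesPair : ∀ {n} → Matrix n → Matrix n → Set (c ⊔ ℓ)
  JonesPair A B =
    Invertible A × NoZeroEntry B ×
    (∀ M → (A ⊗ (B ∘ₘ (A ⊗ M))) ≈ₘ (B ∘ₘ (A ⊗ (B ∘ₘ M)))) ×
    (∀ M → (A ⊗ ((B ᵀ) ∘ₘ (A ⊗ M))) ≈ₘ ((B ᵀ) ∘ₘ (A ⊗ ((B ᵀ) ∘ₘ M))))

  InvertibleJonesPair : ∀ {n} → Matrix n → Matrix n → Set (c ⊔ ℓ)
  InvertibleJonesPair A B = JonesPair A B × NoZeroEntry A × Invertible B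

  -- Θ-rel P Q M T : for all i j,  M (P e_i ∘ Q e_j) = T_ij (P e_i ∘ Q e_j),
  -- i.e. T = Θ_{P,Q}(M) (and M ∈ N_{P,Q}).
  ΘRel : ∀ {n} → Matrix n → Matrix n → Matrix n → Matrix n → Set ℓ
  ΘRel P Q M T = ∀ i j →
    (M ·ᵥ (col P i ∘ᵥ col Q j)) ≈ᵥ (T i j ∙ᵥ (col P i ∘ᵥ col Q j))

  InN : ∀ {n} → Matrix n → Matrix n → Matrix n → Set (c ⊔ ℓ)
  InN P Q M = ∃ λ T → ΘRel P Q M T

  -- 4×4 block matrices of n×n blocks, indexed by Fin (4 * n);
  -- index r corresponds to block ⌊r/n⌋ and position r mod n.
  block4 : ∀ {n} → (Fin 4 → Fin 4 → Matrix n) → Fin (4 ℕ.* n) → Fin (4 ℕ.* n) → Carrier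
  block4 {n} X r s with remQuot {4} n r | remQuot {4} n s
  ... | a , i | b , j = X a b i j

  pattern4 : ∀ {n} → (P Q R S U W : Matrix n) → Fin 4 → Fin 4 → Matrix n
  pattern4 P Q R S U W zero zero = P +ₘ Q
  pattern4 P Q R S U W zero (suc zero) = P -ₘ Q
  pattern4 P Q R S U W zero (suc (suc _)) = R
  pattern4 P Q R S U W (suc zero) zero = P -ₘ Q
  pattern4 P Q R S U W (suc zero) (suc zero) = P +ₘ Q
  pattern4 P Q R S U W (suc zero) (suc (suc _)) = R
  pattern4 P Q R S U W (suc (suc _)) zero = S
  pattern4 P Q R S U W (suc (suc _)) (suc zero) = S
  pattern4 P Q R S U W (suc (suc zero)) (suc (suc zero)) = U +ₘ W
  pattern4 P Q R S U W (suc (suc zero)) (suc (suc (suc _))) = U -ₘ W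
  pattern4 P Q R S U W (suc (suc (suc _))) (suc (suc zero)) = U -ₘ W
  pattern4 P Q R S U W (suc (suc (suc _))) (suc (suc (suc _))) = U +ₘ W

  -- 𝓜(F,G,H) as a relation: "MM is 𝓜(F,G,H)" where the Θ-values are
  -- described relationally (they are unique, the eigenvectors being nonzero).
  IsCalM : ∀ {n} (A B F G H : Matrix n) → (Fin (4 ℕ.* n) → Fin (4 ℕ.* n) → Carrier) → Set (c ⊔ ℓ)
  IsCalM A B F G H MM =
    ∃ λ (ΘAF : Matrix _) → ∃ λ (ΘB'F : Matrix _) → ∃ λ (ΘG : Matrix _) →
    ∃ λ (ΘGᵀ : Matrix _) → ∃ λ (ΘH : Matrix _) → ∃ λ (K : Matrix _) →
    ∃ λ (ΘKᵀ : Matrix _) →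
      ΘRel A (A ⁽⁻⁾) F ΘAF ×
      ΘRel (B ⁽⁻⁾) ((B ⁽⁻⁾) ⁽⁻⁾) F ΘB'F ×
      ΘRel A B G ΘG ×
      ΘRel A B (G ᵀ) ΘGᵀ ×
      ΘRel A B H ΘH ×
      ΘRel A (B ᵀ) (K ᵀ) ΘKᵀ ×
      ((ΘKᵀ ᵀ) ≈ₘ ΘH) ×
      (∀ r s → MM r s ≈ block4 (pattern4 ΘAF H ΘG (ΘGᵀ ᵀ) ΘB'F K) r s)

  InCalB : ∀ {n} (A B : Matrix n) → (Fin (4 ℕ.* n) → Fin (4 ℕ.* n) → Carrier) → Set (c ⊔ ℓ)
  InCalB A B MM = ∃ λ F → ∃ λ G → ∃ λ H →
    InN A (A ⁽⁻⁾) F × InN A B G × InN A B H × IsCalM A B F G H MM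

  Vblocks : ∀ {n} (d : Carrier) (A B : Matrix n) → Fin 4 → Fin 4 → Matrix n
  Vblocks d A B zero zero = d ∙ₘ A
  Vblocks d A B zero (suc zero) = -ₘ (d ∙ₘ A)
  Vblocks d A B zero (suc (suc _)) = B ⁽⁻⁾
  Vblocks d A B (suc zero) zero = -ₘ (d ∙ₘ A)
  Vblocks d A B (suc zero) (suc zero) = d ∙ₘ A
  Vblocks d A B (suc zero) (suc (suc _)) = B ⁽⁻⁾
  Vblocks d A B (suc (suc _)) zero = (B ⁽⁻⁾) ᵀ
  Vblocks d A B (suc (suc _)) (suc zero) = (B ⁽⁻⁾) ᵀ
  Vblocks d A B (suc (suc zero)) (suc (suc zero)) = d ∙ₘ A
  Vblocks d A B (suc (suc zero)) (suc (suc (suc _))) = -ₘ (d ∙ₘ A)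
  Vblocks d A B (suc (suc (suc _))) (suc (suc zero)) = -ₘ (d ∙ₘ A)
  Vblocks d A B (suc (suc (suc _))) (suc (suc (suc _))) = d ∙ₘ A

  Vmat : ∀ {n} (d : Carrier) (A B : Matrix n) → Matrix (4 ℕ.* n)
  Vmat d A B = block4 (Vblocks d A B)

  IsEigenvector : ∀ {m} → Matrix m → Vector m → Set (c ⊔ ℓ)
  IsEigenvector M v = ¬ (∀ k → v k ≈ 0#) × ∃ λ λ₀ → (M ·ᵥ v) ≈ᵥ (λ₀ ∙ᵥ v)

{-# OPTIONS --safe #-}

-- Put αᵢⱼ = Aeᵢ ∘ A⁽⁻⁾eⱼ and βᵢⱼ = B⁽⁻⁾eᵢ ∘ Beⱼ. For r = (2 + c, i) and s = (2 + c′, j) in the lower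
-- half, Veᵣ ∘ V⁽⁻⁾eₛ has the blocks (βᵢⱼ, βᵢⱼ, σαᵢⱼ, σαᵢⱼ) with σ = ±1. The Jones pair equations say
-- Θ_{A,B}(A) = B and Θ_{A,Bᵀ}(A) = Bᵀ. From these, A and B are type II, and B and Bᵀ exchange αᵢⱼ and
-- βᵢⱼ up to the common factor n Aⱼᵢ. Conjugating by B then yields scalars λᵢⱼ and μᵢⱼ with
--   Θ_A(F) βᵢⱼ = λᵢⱼ βᵢⱼ,        Θ_{B⁽⁻⁾}(F) αᵢⱼ = λᵢⱼ αᵢⱼ,
--   Θ_{A,B}(G) αᵢⱼ = μᵢⱼ βᵢⱼ,    Θ_{A,B}(Gᵀ)ᵀ βᵢⱼ = μᵢⱼ αᵢⱼ,
-- the last because Θ_{A,B}(G) B⁻¹ and (Θ_{A,B}(Gᵀ) B⁻¹)ᵀ have the same image under the injective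
-- map Θ_A. On a vector with blocks (x, x, y, y) the blocks ±H and ±K of 𝓜(F,G,H) cancel, so
-- Veᵣ ∘ V⁽⁻⁾eₛ is an eigenvector with eigenvalue 2(λᵢⱼ + σμᵢⱼ).

module Submission where

open import Defs
open import Level using (Level)
open import Data.Nat as ℕ using (ℕ; zero; suc)
open import Data.Fin as Fin using (Fin; zero; suc; toℕ; _↑ˡ_; _↑ʳ_; combine; remQuot)
open import Data.Fin.Properties using (suc-injective; remQuot-combine; combine-remQuot; toℕ-combine; toℕ<n)
import Data.Nat.Properties as ℕₚ
open import Data.Product using (_×_; _,_; proj₁; proj₂; ∃-syntax)
open import Function using (_∘_)
open import Relation.Nullary using (¬_; Dec; yes; no; contradiction)
import Relation.Binary.PropositionalEquality as ≡
open ≡ using (_≢_)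
import Relation.Binary.Reasoning.Setoid as SetoidReasoning
import Algebra.Properties.Ring as RingProperties
import Algebra.Properties.CommutativeSemigroup as CommutativeSemigroupProperties
import Algebra.Properties.Semiring.Sum as SemiringSum
import Algebra.Solver.CommutativeMonoid as CommutativeMonoidSolver

module FieldProperties {c ℓ} (𝔽 : ACF0 c ℓ) where
  open ACF0 𝔽
  open SetoidReasoning setoid
  open RingProperties ring public using (-‿distribˡ-*; -‿involutive; -1*x≈-x)
  open CommutativeSemigroupProperties *-commutativeSemigroup public
    using (x∙yz≈y∙xz; x∙yz≈z∙yx; x∙yz≈yx∙z; interchange)
  module *-Solver = CommutativeMonoidSolver *-commutativeMonoid
  module +-Solver = CommutativeMonoidSolver +-commutativeMonoid

  x⁻¹*x≈1 : ∀ {x} → x ≉ 0# → x ⁻¹ * x ≈ 1#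
  x⁻¹*x≈1 {x} x≉0 = trans (*-comm _ _) (⁻¹-inverse x x≉0)

  *-cancelˡ : ∀ {x y z} → x ≉ 0# → x * y ≈ x * z → y ≈ z
  *-cancelˡ {x} {y} {z} x≉0 xy≈xz = begin
    y                  ≈⟨ *-identityˡ y ⟨
    1# * y             ≈⟨ *-congʳ (x⁻¹*x≈1 x≉0) ⟨
    (x ⁻¹ * x) * y     ≈⟨ *-assoc _ _ _ ⟩
    x ⁻¹ * (x * y)     ≈⟨ *-congˡ xy≈xz ⟩
    x ⁻¹ * (x * z)     ≈⟨ *-assoc _ _ _ ⟨
    (x ⁻¹ * x) * z     ≈⟨ *-congʳ (x⁻¹*x≈1 x≉0) ⟩
    1# * z             ≈⟨ *-identityˡ z ⟩
    z                  ∎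

  x*y≈0⇒y≈0 : ∀ {x y} → x ≉ 0# → x * y ≈ 0# → y ≈ 0#
  x*y≈0⇒y≈0 {x} x≉0 xy≈0 = *-cancelˡ x≉0 (trans xy≈0 (sym (zeroʳ x)))

  x≉0∧y≉0⇒x*y≉0 : ∀ {x y} → x ≉ 0# → y ≉ 0# → x * y ≉ 0#
  x≉0∧y≉0⇒x*y≉0 x≉0 y≉0 xy≈0 = y≉0 (x*y≈0⇒y≈0 x≉0 xy≈0)

  1≉0 : 1# ≉ 0#
  1≉0 1≈0 = 0≉1 (sym 1≈0)

  x⁻¹≉0 : ∀ {x} → x ≉ 0# → x ⁻¹ ≉ 0#
  x⁻¹≉0 {x} x≉0 x⁻¹≈0 = 1≉0 (begin
    1#         ≈⟨ ⁻¹-inverse x x≉0 ⟨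
    x * x ⁻¹   ≈⟨ *-congˡ x⁻¹≈0 ⟩
    x * 0#     ≈⟨ zeroʳ x ⟩
    0#         ∎)

  ⁻¹-unique : ∀ {x y} → x ≉ 0# → x * y ≈ 1# → y ≈ x ⁻¹
  ⁻¹-unique {x} x≉0 xy≈1 = *-cancelˡ x≉0 (trans xy≈1 (sym (⁻¹-inverse x x≉0)))

  ⁻¹-cong : ∀ {x y} → x ≉ 0# → x ≈ y → x ⁻¹ ≈ y ⁻¹
  ⁻¹-cong {x} x≉0 x≈y =
    ⁻¹-unique (x≉0 ∘ trans x≈y) (trans (*-congʳ (sym x≈y)) (⁻¹-inverse x x≉0))

  ⁻¹-cong′ : ∀ {x y} → y ≉ 0# → x ≈ y → x ⁻¹ ≈ y ⁻¹
  ⁻¹-cong′ y≉0 x≈y = sym (⁻¹-cong y≉0 (sym x≈y))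

  ⁻¹-involutive : ∀ {x} → x ≉ 0# → x ⁻¹ ⁻¹ ≈ x
  ⁻¹-involutive x≉0 = sym (⁻¹-unique (x⁻¹≉0 x≉0) (x⁻¹*x≈1 x≉0))

  ⁻¹-distrib-* : ∀ {x y} → x ≉ 0# → y ≉ 0# → (x * y) ⁻¹ ≈ x ⁻¹ * y ⁻¹
  ⁻¹-distrib-* {x} {y} x≉0 y≉0 = sym (⁻¹-unique (x≉0∧y≉0⇒x*y≉0 x≉0 y≉0) (begin
    (x * y) * (x ⁻¹ * y ⁻¹)   ≈⟨ interchange x y (x ⁻¹) (y ⁻¹) ⟩
    (x * x ⁻¹) * (y * y ⁻¹)   ≈⟨ *-cong (⁻¹-inverse x x≉0) (⁻¹-inverse y y≉0) ⟩
    1# * 1#                   ≈⟨ *-identityˡ 1# ⟩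
    1#                        ∎))

  x*y≈z⇒y≈x⁻¹*z : ∀ {x y z} → x ≉ 0# → x * y ≈ z → y ≈ x ⁻¹ * z
  x*y≈z⇒y≈x⁻¹*z {x} {y} {z} x≉0 xy≈z = *-cancelˡ x≉0 (begin
    x * y               ≈⟨ xy≈z ⟩
    z                   ≈⟨ *-identityˡ z ⟨
    1# * z              ≈⟨ *-congʳ (⁻¹-inverse x x≉0) ⟨
    (x * x ⁻¹) * z      ≈⟨ *-assoc _ _ _ ⟩
    x * (x ⁻¹ * z)      ∎)

  x*x≈1⇒x≉0 : ∀ {x} → x * x ≈ 1# → x ≉ 0#
  x*x≈1⇒x≉0 {x} xx≈1 x≈0 = 1≉0 (trans (sym xx≈1) (trans (*-congʳ x≈0) (zeroˡ x)))

  x*x≈1⇒x⁻¹≈x : ∀ {x} → x * x ≈ 1# → x ⁻¹ ≈ x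
  x*x≈1⇒x⁻¹≈x xx≈1 = sym (⁻¹-unique (x*x≈1⇒x≉0 xx≈1) xx≈1)

  fromℕ≉0 : ∀ {n} → Fin n → fromℕ n ≉ 0#
  fromℕ≉0 {suc n} _ = char0 n

  sign : Fin 2 → Carrier
  sign zero    = 1#
  sign (suc _) = - 1#

  sign*sign≈1 : ∀ e → sign e * sign e ≈ 1#
  sign*sign≈1 zero    = *-identityˡ 1#
  sign*sign≈1 (suc _) = trans (-1*x≈-x (- 1#)) (-‿involutive 1#)

  signs*signs≈1 : ∀ e c → (sign e * sign c) * (sign e * sign c) ≈ 1#
  signs*signs≈1 e c = trans (interchange _ _ _ _) (trans (*-cong (sign*sign≈1 e) (sign*sign≈1 c)) (*-identityˡ 1#))

  signed-ratio : ∀ e c c′ {d a b} → d ≉ 0# → b ≉ 0# →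
                 ((sign e * sign c) * (d * a)) * ((sign e * sign c′) * (d * b)) ⁻¹ ≈ (sign c * sign c′) * (a * b ⁻¹)
  signed-ratio e c c′ {d} {a} {b} d≉0 b≉0 = begin
    ((sign e * sign c) * (d * a)) * ((sign e * sign c′) * (d * b)) ⁻¹
      ≈⟨ *-congˡ (⁻¹-distrib-* (x*x≈1⇒x≉0 (signs*signs≈1 e c′)) (x≉0∧y≉0⇒x*y≉0 d≉0 b≉0)) ⟩
    ((sign e * sign c) * (d * a)) * ((sign e * sign c′) ⁻¹ * (d * b) ⁻¹)
      ≈⟨ *-congˡ (*-cong (x*x≈1⇒x⁻¹≈x (signs*signs≈1 e c′)) (⁻¹-distrib-* d≉0 b≉0)) ⟩
    ((sign e * sign c) * (d * a)) * ((sign e * sign c′) * (d ⁻¹ * b ⁻¹))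
      ≈⟨ solve 7 (λ x y y′ u a u⁻ b⁻ → ((x ⊕ y) ⊕ (u ⊕ a)) ⊕ ((x ⊕ y′) ⊕ (u⁻ ⊕ b⁻))
                                     ⊜ ((x ⊕ x) ⊕ (u ⊕ u⁻)) ⊕ ((y ⊕ y′) ⊕ (a ⊕ b⁻)))
                 refl (sign e) (sign c) (sign c′) d a (d ⁻¹) (b ⁻¹) ⟩
    ((sign e * sign e) * (d * d ⁻¹)) * ((sign c * sign c′) * (a * b ⁻¹))
      ≈⟨ *-congʳ (trans (*-cong (sign*sign≈1 e) (⁻¹-inverse d d≉0)) (*-identityˡ 1#)) ⟩
    1# * ((sign c * sign c′) * (a * b ⁻¹))
      ≈⟨ *-identityˡ _ ⟩
    (sign c * sign c′) * (a * b ⁻¹) ∎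
    where open *-Solver using (solve; _⊕_; _⊜_)

  +-cancel-pair : ∀ {x h h′ y} → h + h′ ≈ 0# → (x + h) + ((x + h′) + y) ≈ (x + x) + y
  +-cancel-pair {x} {h} {h′} {y} h+h′≈0 = begin
    (x + h) + ((x + h′) + y)
      ≈⟨ solve 4 (λ x h h′ y → (x ⊕ h) ⊕ ((x ⊕ h′) ⊕ y) ⊜ ((x ⊕ x) ⊕ y) ⊕ (h ⊕ h′)) refl x h h′ y ⟩
    ((x + x) + y) + (h + h′)
      ≈⟨ +-congˡ h+h′≈0 ⟩
    ((x + x) + y) + 0#
      ≈⟨ +-identityʳ _ ⟩
    (x + x) + y ∎
    where open +-Solver using (solve; _⊕_; _⊜_)

module Summation {c ℓ} (𝔽 : ACF0 c ℓ) where
  open ACF0 𝔽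
  open Matrices 𝔽 using (Σ[_])
  open FieldProperties 𝔽 using (-1*x≈-x)
  open SetoidReasoning setoid
  open SemiringSum semiring using (sum; sum-cong-≋; sum-cong-≗; ∑-distrib-+; ∑-comm; *-distribˡ-sum; *-distribʳ-sum)

  Σ≡sum : ∀ {n} (f : Fin n → Carrier) → Σ[ f ] ≡.≡ sum f
  Σ≡sum {zero}  f = ≡.refl
  Σ≡sum {suc n} f = ≡.cong (f zero +_) (Σ≡sum (f ∘ suc))

  Σ-cong : ∀ {n} {f g : Fin n → Carrier} → (∀ i → f i ≈ g i) → Σ[ f ] ≈ Σ[ g ]
  Σ-cong {f = f} {g} f≈g = begin
    Σ[ f ]   ≡⟨ Σ≡sum f ⟩
    sum f    ≈⟨ sum-cong-≋ f≈g ⟩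
    sum g    ≡⟨ Σ≡sum g ⟨
    Σ[ g ]   ∎

  Σ-distrib-+ : ∀ {n} (f g : Fin n → Carrier) → Σ[ (λ i → f i + g i) ] ≈ Σ[ f ] + Σ[ g ]
  Σ-distrib-+ f g = begin
    Σ[ (λ i → f i + g i) ]   ≡⟨ Σ≡sum (λ i → f i + g i) ⟩
    sum (λ i → f i + g i)    ≈⟨ ∑-distrib-+ f g ⟩
    sum f + sum g            ≡⟨ ≡.cong₂ _+_ (Σ≡sum f) (Σ≡sum g) ⟨
    Σ[ f ] + Σ[ g ]          ∎

  *-distribˡ-Σ : ∀ {n} x (f : Fin n → Carrier) → Σ[ (λ i → x * f i) ] ≈ x * Σ[ f ]
  *-distribˡ-Σ x f = begin
    Σ[ (λ i → x * f i) ]   ≡⟨ Σ≡sum (λ i → x * f i) ⟩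
    sum (λ i → x * f i)    ≈⟨ *-distribˡ-sum x f ⟨
    x * sum f              ≡⟨ ≡.cong (x *_) (Σ≡sum f) ⟨
    x * Σ[ f ]             ∎

  *-distribʳ-Σ : ∀ {n} x (f : Fin n → Carrier) → Σ[ (λ i → f i * x) ] ≈ Σ[ f ] * x
  *-distribʳ-Σ x f = begin
    Σ[ (λ i → f i * x) ]   ≡⟨ Σ≡sum (λ i → f i * x) ⟩
    sum (λ i → f i * x)    ≈⟨ *-distribʳ-sum x f ⟨
    sum f * x              ≡⟨ ≡.cong (_* x) (Σ≡sum f) ⟨
    Σ[ f ] * x             ∎

  Σ-comm : ∀ {m n} (f : Fin m → Fin n → Carrier) →
           Σ[ (λ i → Σ[ f i ]) ] ≈ Σ[ (λ j → Σ[ (λ i → f i j) ]) ]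
  Σ-comm f = begin
    Σ[ (λ i → Σ[ f i ]) ]                   ≡⟨ Σ≡sum (λ i → Σ[ f i ]) ⟩
    sum (λ i → Σ[ f i ])                    ≡⟨ sum-cong-≗ (λ i → Σ≡sum (f i)) ⟩
    sum (λ i → sum (f i))                   ≈⟨ ∑-comm f ⟩
    sum (λ j → sum (λ i → f i j))           ≡⟨ sum-cong-≗ (λ j → Σ≡sum (λ i → f i j)) ⟨
    sum (λ j → Σ[ (λ i → f i j) ])          ≡⟨ Σ≡sum (λ j → Σ[ (λ i → f i j) ]) ⟨
    Σ[ (λ j → Σ[ (λ i → f i j) ]) ]         ∎

  Σ-const : ∀ {n} x → Σ[ (λ (_ : Fin n) → x) ] ≈ fromℕ n * x
  Σ-const {zero}  x = sym (zeroˡ x)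
  Σ-const {suc n} x = begin
    x + Σ[ (λ (_ : Fin n) → x) ]   ≈⟨ +-cong (sym (*-identityˡ x)) (Σ-const {n} x) ⟩
    1# * x + fromℕ n * x           ≈⟨ distribʳ x 1# (fromℕ n) ⟨
    (1# + fromℕ n) * x             ∎

  Σ-neg : ∀ {n} (f : Fin n → Carrier) → Σ[ (λ i → - f i) ] ≈ - Σ[ f ]
  Σ-neg f = begin
    Σ[ (λ i → - f i) ]        ≈⟨ Σ-cong (λ i → -1*x≈-x (f i)) ⟨
    Σ[ (λ i → - 1# * f i) ]   ≈⟨ *-distribˡ-Σ (- 1#) f ⟩
    - 1# * Σ[ f ]             ≈⟨ -1*x≈-x _ ⟩
    - Σ[ f ]                  ∎

  Σ-split : ∀ m {n} (f : Fin (m ℕ.+ n) → Carrier) →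
            Σ[ f ] ≈ Σ[ (λ i → f (i ↑ˡ n)) ] + Σ[ (λ j → f (m ↑ʳ j)) ]
  Σ-split zero    f = sym (+-identityˡ _)
  Σ-split (suc m) f = trans (+-congˡ (Σ-split m (f ∘ suc))) (sym (+-assoc _ _ _))

  Σ-combine : ∀ m {n} (f : Fin (m ℕ.* n) → Carrier) →
              Σ[ f ] ≈ Σ[ (λ (a : Fin m) → Σ[ (λ (p : Fin n) → f (combine a p)) ]) ]
  Σ-combine zero        f = refl
  Σ-combine (suc m) {n} f =
    trans (Σ-split n {m ℕ.* n} f) (+-congˡ (Σ-combine m {n} (f ∘ (n ↑ʳ_))))

module MatrixAlgebra {c ℓ} (𝔽 : ACF0 c ℓ) where
  open ACF0 𝔽
  open Matrices 𝔽
  open FieldProperties 𝔽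
  open Summation 𝔽
  open SetoidReasoning setoid

  I-ondiag : ∀ {n} {i j : Fin n} → i ≡.≡ j → I i j ≈ 1#
  I-ondiag {i = i} {j} i≡j with i Fin.≟ j
  ... | yes _   = refl
  ... | no i≢j = contradiction i≡j i≢j

  I-diag : ∀ {n} (i : Fin n) → I i i ≈ 1#
  I-diag i = I-ondiag {i = i} ≡.refl

  I-offdiag : ∀ {n} {i j : Fin n} → i ≢ j → I i j ≈ 0#
  I-offdiag {i = i} {j} i≢j with i Fin.≟ j
  ... | yes i≡j = contradiction i≡j i≢j
  ... | no _    = refl

  I-sym : ∀ {n} (i j : Fin n) → I i j ≈ I j i
  I-sym i j with i Fin.≟ j
  ... | yes i≡j = sym (I-ondiag (≡.sym i≡j))
  ... | no i≢j  = sym (I-offdiag (i≢j ∘ ≡.sym))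

  I-suc : ∀ {n} (i j : Fin n) → I (suc i) (suc j) ≈ I i j
  I-suc i j = by-cases (i Fin.≟ j)
    where
    by-cases : Dec (i ≡.≡ j) → I (suc i) (suc j) ≈ I i j
    by-cases (yes i≡j) = trans (I-ondiag (≡.cong suc i≡j)) (sym (I-ondiag i≡j))
    by-cases (no i≢j)  = trans (I-offdiag (i≢j ∘ suc-injective)) (sym (I-offdiag i≢j))

  Σ-*I : ∀ {n} (f : Fin n → Carrier) j → Σ[ (λ k → f k * I k j) ] ≈ f j
  Σ-*I {suc n} f zero = begin
    f zero * I {suc n} zero zero + Σ[ (λ k → f (suc k) * I (suc k) zero) ]
      ≈⟨ +-cong (*-congˡ (I-diag {suc n} zero)) (Σ-cong {n} (λ k → *-congˡ (I-offdiag {i = suc k} {zero} λ ()))) ⟩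
    f zero * 1# + Σ[ (λ k → f (suc k) * 0#) ]
      ≈⟨ +-cong (*-identityʳ _) (trans (Σ-cong (λ k → zeroʳ (f (suc k)))) (Σ-const {n} 0#)) ⟩
    f zero + fromℕ n * 0#
      ≈⟨ trans (+-congˡ (zeroʳ _)) (+-identityʳ _) ⟩
    f zero ∎
  Σ-*I {suc n} f (suc j) = begin
    f zero * I {suc n} zero (suc j) + Σ[ (λ k → f (suc k) * I (suc k) (suc j)) ]
      ≈⟨ +-cong (*-congˡ (I-offdiag {i = zero} {suc j} λ ())) (Σ-cong {n} (λ k → *-congˡ (I-suc k j))) ⟩
    f zero * 0# + Σ[ (λ k → f (suc k) * I k j) ]
      ≈⟨ +-cong (zeroʳ _) (Σ-*I (f ∘ suc) j) ⟩
    0# + f (suc j)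
      ≈⟨ +-identityˡ _ ⟩
    f (suc j) ∎

  Σ-I* : ∀ {n} (f : Fin n → Carrier) j → Σ[ (λ k → I j k * f k) ] ≈ f j
  Σ-I* f j = trans (Σ-cong (λ k → trans (*-comm _ _) (*-congˡ (I-sym j k)))) (Σ-*I f j)

  Σ-assoc : ∀ {m n} (f : Fin m → Carrier) (g : Fin m → Fin n → Carrier) (h : Fin n → Carrier) →
            Σ[ (λ b → Σ[ (λ l → f l * g l b) ] * h b) ] ≈ Σ[ (λ l → f l * Σ[ (λ b → g l b * h b) ]) ]
  Σ-assoc f g h = begin
    Σ[ (λ b → Σ[ (λ l → f l * g l b) ] * h b) ]
      ≈⟨ Σ-cong (λ b → *-distribʳ-Σ (h b) (λ l → f l * g l b)) ⟨
    Σ[ (λ b → Σ[ (λ l → (f l * g l b) * h b) ]) ]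
      ≈⟨ Σ-comm (λ b l → (f l * g l b) * h b) ⟩
    Σ[ (λ l → Σ[ (λ b → (f l * g l b) * h b) ]) ]
      ≈⟨ Σ-cong (λ l → trans (Σ-cong (λ b → *-assoc (f l) (g l b) (h b)))
                             (*-distribˡ-Σ (f l) (λ b → g l b * h b))) ⟩
    Σ[ (λ l → f l * Σ[ (λ b → g l b * h b) ]) ] ∎

  ·ᵥ-congʳ : ∀ {n} (X : Matrix n) {v w : Vector n} → v ≈ᵥ w → (X ·ᵥ v) ≈ᵥ (X ·ᵥ w)
  ·ᵥ-congʳ X v≈w i = Σ-cong (λ k → *-congˡ (v≈w k))

  ·ᵥ-congˡ : ∀ {n} {X Y : Matrix n} (v : Vector n) → X ≈ₘ Y → (X ·ᵥ v) ≈ᵥ (Y ·ᵥ v)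
  ·ᵥ-congˡ v X≈Y i = Σ-cong (λ k → *-congʳ (X≈Y i k))

  ·ᵥ-∙ᵥ : ∀ {n} (X : Matrix n) x (v : Vector n) → (X ·ᵥ (x ∙ᵥ v)) ≈ᵥ (x ∙ᵥ (X ·ᵥ v))
  ·ᵥ-∙ᵥ X x v i = trans (Σ-cong (λ k → x∙yz≈y∙xz (X i k) x (v k))) (*-distribˡ-Σ x (λ k → X i k * v k))

  ∙ₘ-·ᵥ : ∀ {n} x (M : Matrix n) (v : Vector n) → ((x ∙ₘ M) ·ᵥ v) ≈ᵥ (x ∙ᵥ (M ·ᵥ v))
  ∙ₘ-·ᵥ x M v i = trans (Σ-cong (λ k → *-assoc x (M i k) (v k))) (*-distribˡ-Σ x (λ k → M i k * v k))

  ⊗-·ᵥ : ∀ {n} (X Y : Matrix n) (v : Vector n) → ((X ⊗ Y) ·ᵥ v) ≈ᵥ (X ·ᵥ (Y ·ᵥ v))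
  ⊗-·ᵥ X Y v i = Σ-assoc (X i) Y v

  I-·ᵥ : ∀ {n} (v : Vector n) → (I ·ᵥ v) ≈ᵥ v
  I-·ᵥ v i = Σ-I* v i

  +ₘ-·ᵥ : ∀ {n} (X Y : Matrix n) (v : Vector n) i → ((X +ₘ Y) ·ᵥ v) i ≈ (X ·ᵥ v) i + (Y ·ᵥ v) i
  +ₘ-·ᵥ X Y v i = trans (Σ-cong (λ k → distribʳ (v k) (X i k) (Y i k)))
                        (Σ-distrib-+ (λ k → X i k * v k) (λ k → Y i k * v k))

  -ₘ-·ᵥ : ∀ {n} (X Y : Matrix n) (v : Vector n) i → ((X -ₘ Y) ·ᵥ v) i ≈ (X ·ᵥ v) i - (Y ·ᵥ v) i
  -ₘ-·ᵥ X Y v i = begin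
    Σ[ (λ k → (X i k - Y i k) * v k) ]
      ≈⟨ Σ-cong (λ k → trans (distribʳ (v k) (X i k) (- Y i k)) (+-congˡ (sym (-‿distribˡ-* (Y i k) (v k))))) ⟩
    Σ[ (λ k → X i k * v k - Y i k * v k) ]
      ≈⟨ Σ-distrib-+ (λ k → X i k * v k) (λ k → - (Y i k * v k)) ⟩
    (X ·ᵥ v) i + Σ[ (λ k → - (Y i k * v k)) ]
      ≈⟨ +-congˡ (Σ-neg (λ k → Y i k * v k)) ⟩
    (X ·ᵥ v) i - (Y ·ᵥ v) i ∎

  ·ᵥ-image-cong : ∀ {n} {M : Matrix n} {v v′ u u′ : Vector n} {x} → v ≈ᵥ v′ → u ≈ᵥ u′ →
                  (M ·ᵥ v) ≈ᵥ (x ∙ᵥ u) → (M ·ᵥ v′) ≈ᵥ (x ∙ᵥ u′)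
  ·ᵥ-image-cong {M = M} {v} {v′} {x = x} v≈v′ u≈u′ Mv≈xu i =
    trans (sym (·ᵥ-congʳ M v≈v′ i)) (trans (Mv≈xu i) (*-congˡ (u≈u′ i)))

  ·ᵥ-invert : ∀ {n} {B Z : Matrix n} {p q : Vector n} {x} → (Z ⊗ B) ≈ₘ I →
              (B ·ᵥ p) ≈ᵥ (x ∙ᵥ q) → (x ∙ᵥ (Z ·ᵥ q)) ≈ᵥ p
  ·ᵥ-invert {B = B} {Z} {p} {q} {x} ZB≈I Bp≈xq i = begin
    x * (Z ·ᵥ q) i        ≈⟨ ·ᵥ-∙ᵥ Z x q i ⟨
    (Z ·ᵥ (x ∙ᵥ q)) i     ≈⟨ ·ᵥ-congʳ Z Bp≈xq i ⟨
    (Z ·ᵥ (B ·ᵥ p)) i     ≈⟨ ⊗-·ᵥ Z B p i ⟨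
    ((Z ⊗ B) ·ᵥ p) i      ≈⟨ ·ᵥ-congˡ p ZB≈I i ⟩
    (I ·ᵥ p) i            ≈⟨ I-·ᵥ p i ⟩
    p i                   ∎

  eigenvector-conjugate : ∀ {n} {B Z W : Matrix n} {p q : Vector n} {x θ} → (Z ⊗ B) ≈ₘ I →
                          (B ·ᵥ p) ≈ᵥ (x ∙ᵥ q) → (W ·ᵥ q) ≈ᵥ (θ ∙ᵥ q) →
                          ((Z ⊗ (W ⊗ B)) ·ᵥ p) ≈ᵥ (θ ∙ᵥ p)
  eigenvector-conjugate {B = B} {Z} {W} {p} {q} {x} {θ} ZB≈I Bp≈xq Wq≈θq i = begin
    ((Z ⊗ (W ⊗ B)) ·ᵥ p) i          ≈⟨ ⊗-·ᵥ Z (W ⊗ B) p i ⟩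
    (Z ·ᵥ ((W ⊗ B) ·ᵥ p)) i         ≈⟨ ·ᵥ-congʳ Z WBp≈θxq i ⟩
    (Z ·ᵥ (θ ∙ᵥ (x ∙ᵥ q))) i        ≈⟨ ·ᵥ-∙ᵥ Z θ (x ∙ᵥ q) i ⟩
    θ * (Z ·ᵥ (x ∙ᵥ q)) i           ≈⟨ *-congˡ (·ᵥ-∙ᵥ Z x q i) ⟩
    θ * (x * (Z ·ᵥ q) i)            ≈⟨ *-congˡ (·ᵥ-invert ZB≈I Bp≈xq i) ⟩
    θ * p i                         ∎
    where
    WBp≈θxq : ((W ⊗ B) ·ᵥ p) ≈ᵥ (θ ∙ᵥ (x ∙ᵥ q))
    WBp≈θxq k = begin
      ((W ⊗ B) ·ᵥ p) k         ≈⟨ ⊗-·ᵥ W B p k ⟩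
      (W ·ᵥ (B ·ᵥ p)) k        ≈⟨ ·ᵥ-congʳ W Bp≈xq k ⟩
      (W ·ᵥ (x ∙ᵥ q)) k        ≈⟨ ·ᵥ-∙ᵥ W x q k ⟩
      x * (W ·ᵥ q) k           ≈⟨ *-congˡ (Wq≈θq k) ⟩
      x * (θ * q k)            ≈⟨ x∙yz≈y∙xz x θ (q k) ⟩
      θ * (x * q k)            ∎

  inverse-symmetric : ∀ {n} {A A⁻¹ : Matrix n} → Symmetric A → (A ⊗ A⁻¹) ≈ₘ I → Symmetric A⁻¹
  inverse-symmetric {A = A} {A⁻¹} A-sym A⊗A⁻¹≈I i t = begin
    A⁻¹ t i                                        ≈⟨ Σ-*I (λ k → A⁻¹ k i) t ⟨
    Σ[ (λ k → A⁻¹ k i * I k t) ]                   ≈⟨ Σ-cong (λ k → *-congˡ (A⊗A⁻¹≈I k t)) ⟨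
    Σ[ (λ k → A⁻¹ k i * (A ⊗ A⁻¹) k t) ]           ≈⟨ Σ-assoc (λ k → A⁻¹ k i) A (λ l → A⁻¹ l t) ⟨
    Σ[ (λ l → Σ[ (λ k → A⁻¹ k i * A k l) ] * A⁻¹ l t) ]
      ≈⟨ Σ-cong (λ l → *-congʳ (trans (Σ-cong (λ k → trans (*-comm _ _) (*-congʳ (sym (A-sym k l)))))
                                       (A⊗A⁻¹≈I l i))) ⟩
    Σ[ (λ l → I l i * A⁻¹ l t) ]                   ≈⟨ Σ-cong (λ l → *-congʳ (I-sym l i)) ⟩
    Σ[ (λ l → I i l * A⁻¹ l t) ]                   ≈⟨ Σ-I* (λ l → A⁻¹ l t) i ⟩
    A⁻¹ i t                                        ∎

  ᵀ-inverse : ∀ {n} {W W⁻¹ : Matrix n} → (W⁻¹ ⊗ W) ≈ₘ I → ((W ᵀ) ⊗ (W⁻¹ ᵀ)) ≈ₘ I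
  ᵀ-inverse {W = W} {W⁻¹} W⁻¹⊗W≈I i j =
    trans (Σ-cong (λ k → *-comm (W k i) (W⁻¹ j k))) (trans (W⁻¹⊗W≈I j i) (I-sym j i))

  ᵀ-⊗-inverse : ∀ {n} {B Z : Matrix n} (X : Matrix n) → (Z ⊗ B) ≈ₘ I → ((B ᵀ) ⊗ ((X ⊗ Z) ᵀ)) ≈ₘ (X ᵀ)
  ᵀ-⊗-inverse {B = B} {Z} X Z⊗B≈I a l = begin
    Σ[ (λ k → B k a * (X ⊗ Z) l k) ]      ≈⟨ Σ-cong (λ k → *-comm (B k a) ((X ⊗ Z) l k)) ⟩
    Σ[ (λ k → (X ⊗ Z) l k * B k a) ]      ≈⟨ Σ-assoc (X l) Z (λ k → B k a) ⟩
    Σ[ (λ m → X l m * (Z ⊗ B) m a) ]      ≈⟨ Σ-cong (λ m → *-congˡ (Z⊗B≈I m a)) ⟩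
    Σ[ (λ m → X l m * I m a) ]            ≈⟨ Σ-*I (X l) a ⟩
    X l a                                 ∎

module NomuraAlgebras {c ℓ} (𝔽 : ACF0 c ℓ) where
  open ACF0 𝔽
  open Matrices 𝔽
  open FieldProperties 𝔽
  open Summation 𝔽
  open MatrixAlgebra 𝔽
  open SetoidReasoning setoid

  jones⇒ΘRel : ∀ {n} {A C : Matrix n} → (∀ M → (A ⊗ (C ∘ₘ (A ⊗ M))) ≈ₘ (C ∘ₘ (A ⊗ (C ∘ₘ M)))) →
               ΘRel A C A C
  jones⇒ΘRel {A = A} {C} jones i j k = begin
    Σ[ (λ l → A k l * (A l i * C l j)) ]
      ≈⟨ Σ-cong (λ l → *-congˡ (trans (*-comm _ _) (*-congˡ (sym (Σ-*I (A l) i))))) ⟩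
    Σ[ (λ l → A k l * (C l j * (A ⊗ eᵢ) l j)) ]
      ≈⟨ jones eᵢ k j ⟩
    C k j * Σ[ (λ l → A k l * (C l j * I l i)) ]
      ≈⟨ *-congˡ (trans (Σ-cong (λ l → sym (*-assoc (A k l) (C l j) (I l i)))) (Σ-*I (λ l → A k l * C l j) i)) ⟩
    C k j * (A k i * C i j)
      ≈⟨ x∙yz≈z∙yx (C k j) (A k i) (C i j) ⟩
    C i j * (A k i * C k j) ∎
    where
    eᵢ : Matrix _
    eᵢ r _ = I r i

  Θ-exchange : ∀ {n} {P Q M Θ : Matrix n} → NoZeroEntry P →
               (Q ⊗ ((Q ⁽⁻⁾) ᵀ)) ≈ₘ (fromℕ n ∙ₘ I) → ΘRel P Q M Θ → ∀ k y →
               (Θ ·ᵥ (col (Q ᵀ) k ∘ᵥ col ((Q ⁽⁻⁾) ᵀ) y))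
                 ≈ᵥ ((fromℕ n * M k y) ∙ᵥ (col ((P ⁽⁻⁾) ᵀ) k ∘ᵥ col (P ᵀ) y))
  Θ-exchange {n} {P} {Q} {M} {Θ} P≉0 QQ⁻≈nI ΘPQ k y a = begin
    Σ[ (λ b → Θ a b * (Q k b * Q y b ⁻¹)) ]
      ≈⟨ Σ-cong Θ-entry ⟩
    Σ[ (λ b → P k a ⁻¹ * (Σ[ (λ l → (M k l * P l a) * Q l b) ] * Q y b ⁻¹)) ]
      ≈⟨ *-distribˡ-Σ (P k a ⁻¹) (λ b → Σ[ (λ l → (M k l * P l a) * Q l b) ] * Q y b ⁻¹) ⟩
    P k a ⁻¹ * Σ[ (λ b → Σ[ (λ l → (M k l * P l a) * Q l b) ] * Q y b ⁻¹) ]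
      ≈⟨ *-congˡ (Σ-assoc (λ l → M k l * P l a) Q (λ b → Q y b ⁻¹)) ⟩
    P k a ⁻¹ * Σ[ (λ l → (M k l * P l a) * (Q ⊗ ((Q ⁽⁻⁾) ᵀ)) l y) ]
      ≈⟨ *-congˡ (Σ-cong (λ l → *-congˡ (QQ⁻≈nI l y))) ⟩
    P k a ⁻¹ * Σ[ (λ l → (M k l * P l a) * (fromℕ n * I l y)) ]
      ≈⟨ *-congˡ (Σ-cong (λ l → x∙yz≈y∙xz (M k l * P l a) (fromℕ n) (I l y))) ⟩
    P k a ⁻¹ * Σ[ (λ l → fromℕ n * ((M k l * P l a) * I l y)) ]
      ≈⟨ *-congˡ (trans (*-distribˡ-Σ (fromℕ n) (λ l → (M k l * P l a) * I l y))
                        (*-congˡ (Σ-*I (λ l → M k l * P l a) y))) ⟩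
    P k a ⁻¹ * (fromℕ n * (M k y * P y a))
      ≈⟨ solve 4 (λ a⁻ n m p → a⁻ ⊕ (n ⊕ (m ⊕ p)) ⊜ (n ⊕ m) ⊕ (a⁻ ⊕ p))
                 refl (P k a ⁻¹) (fromℕ n) (M k y) (P y a) ⟩
    (fromℕ n * M k y) * (P k a ⁻¹ * P y a) ∎
    where
    open *-Solver using (solve; _⊕_; _⊜_)
    Θ-entry : ∀ b → Θ a b * (Q k b * Q y b ⁻¹)
                      ≈ P k a ⁻¹ * (Σ[ (λ l → (M k l * P l a) * Q l b) ] * Q y b ⁻¹)
    Θ-entry b = sym (begin
      P k a ⁻¹ * (Σ[ (λ l → (M k l * P l a) * Q l b) ] * Q y b ⁻¹)
        ≈⟨ *-congˡ (*-congʳ (trans (Σ-cong (λ l → *-assoc (M k l) (P l a) (Q l b))) (ΘPQ a b k))) ⟩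
      P k a ⁻¹ * ((Θ a b * (P k a * Q k b)) * Q y b ⁻¹)
        ≈⟨ solve 5 (λ a⁻ θ a q r → a⁻ ⊕ ((θ ⊕ (a ⊕ q)) ⊕ r) ⊜ (a⁻ ⊕ a) ⊕ (θ ⊕ (q ⊕ r))) refl
                   (P k a ⁻¹) (Θ a b) (P k a) (Q k b) (Q y b ⁻¹) ⟩
      (P k a ⁻¹ * P k a) * (Θ a b * (Q k b * Q y b ⁻¹))
        ≈⟨ *-congʳ (x⁻¹*x≈1 (P≉0 k a)) ⟩
      1# * (Θ a b * (Q k b * Q y b ⁻¹))
        ≈⟨ *-identityˡ _ ⟩
      Θ a b * (Q k b * Q y b ⁻¹) ∎)

  ΘRel-inverse : ∀ {n} {P Q M M⁻¹ T : Matrix n} → (M⁻¹ ⊗ M) ≈ₘ I → NoZeroEntry T →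
                 ΘRel P Q M T → ΘRel P Q M⁻¹ (T ⁽⁻⁾)
  ΘRel-inverse M⁻¹⊗M≈I T≉0 ΘM i j k =
    x*y≈z⇒y≈x⁻¹*z (T≉0 i j) (·ᵥ-invert M⁻¹⊗M≈I (ΘM i j) k)

  ΘRel-unique : ∀ {n} {P Q M T T′ : Matrix n} → NoZeroEntry P → NoZeroEntry Q → Fin n →
                ΘRel P Q M T → ΘRel P Q M T′ → T ≈ₘ T′
  ΘRel-unique P≉0 Q≉0 k ΘM ΘM′ i j = sym (*-cancelˡ (x≉0∧y≉0⇒x*y≉0 (P≉0 k i) (Q≉0 k j))
    (trans (*-comm _ _) (trans (sym (ΘM′ i j k)) (trans (ΘM i j k) (*-comm _ _)))))

  ΘRel-cancel : ∀ {n} {P Q M T : Matrix n} {x} → x ≉ 0# → ΘRel P Q (x ∙ₘ M) (x ∙ₘ T) → ΘRel P Q M T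
  ΘRel-cancel {P = P} {Q} {M} {T} {x} x≉0 ΘxM i j k = *-cancelˡ x≉0 (begin
    x * (M ·ᵥ w) k          ≈⟨ ∙ₘ-·ᵥ x M w k ⟨
    ((x ∙ₘ M) ·ᵥ w) k       ≈⟨ ΘxM i j k ⟩
    (x * T i j) * w k       ≈⟨ *-assoc x (T i j) (w k) ⟩
    x * (T i j * w k)       ∎)
    where
    w : Vector _
    w = col P i ∘ᵥ col Q j

  typeII-from-inverse : ∀ {n} {W W⁻¹ : Matrix n} → NoZeroEntry W → (W ⊗ W⁻¹) ≈ₘ I →
                        (∀ i t → W i t ⁻¹ ≈ fromℕ n * W⁻¹ t i) → TypeII W
  typeII-from-inverse {n} {W} {W⁻¹} W≉0 W⊗W⁻¹≈I W⁻¹-entry = W≉0 , λ l y → begin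
    Σ[ (λ b → W l b * W y b ⁻¹) ]
      ≈⟨ Σ-cong (λ b → *-congˡ (W⁻¹-entry y b)) ⟩
    Σ[ (λ b → W l b * (fromℕ n * W⁻¹ b y)) ]
      ≈⟨ Σ-cong (λ b → x∙yz≈y∙xz (W l b) (fromℕ n) (W⁻¹ b y)) ⟩
    Σ[ (λ b → fromℕ n * (W l b * W⁻¹ b y)) ]
      ≈⟨ *-distribˡ-Σ (fromℕ n) (λ b → W l b * W⁻¹ b y) ⟩
    fromℕ n * (W ⊗ W⁻¹) l y
      ≈⟨ *-congˡ (W⊗W⁻¹≈I l y) ⟩
    fromℕ n * I l y ∎

  typeII-⁽⁻⁾ : ∀ {n} {W : Matrix n} → TypeII W → TypeII (W ⁽⁻⁾)
  typeII-⁽⁻⁾ {n} {W} (W≉0 , W⊗W⁻ᵀ≈nI) = (λ i j → x⁻¹≉0 (W≉0 i j)) , λ l y → begin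
    Σ[ (λ b → W l b ⁻¹ * W y b ⁻¹ ⁻¹) ]
      ≈⟨ Σ-cong (λ b → trans (*-congˡ (⁻¹-involutive (W≉0 y b))) (*-comm _ _)) ⟩
    Σ[ (λ b → W y b * W l b ⁻¹) ]
      ≈⟨ W⊗W⁻ᵀ≈nI y l ⟩
    fromℕ n * I y l
      ≈⟨ *-congˡ (I-sym y l) ⟩
    fromℕ n * I l y ∎

module BlockMatrices {c ℓ} (𝔽 : ACF0 c ℓ) where
  open ACF0 𝔽
  open Matrices 𝔽
  open FieldProperties 𝔽
  open Summation 𝔽
  open MatrixAlgebra 𝔽
  open SetoidReasoning setoid

  block4-combine : ∀ {n} (X : Fin 4 → Fin 4 → Matrix n) a b p q →
                   block4 X (combine a p) (combine b q) ≡.≡ X a b p q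
  block4-combine {n} X a b p q =
    ≡.trans (unfold (combine a p) (combine b q)) (≡.cong₂ entry (remQuot-combine a p) (remQuot-combine b q))
    where
    entry : Fin 4 × Fin n → Fin 4 × Fin n → Carrier
    entry (a , p) (b , q) = X a b p q
    unfold : ∀ r s → block4 X r s ≡.≡ entry (remQuot {4} n r) (remQuot {4} n s)
    unfold r s with remQuot {4} n r | remQuot {4} n s
    ... | _ , _ | _ , _ = ≡.refl

  block4-·ᵥ : ∀ {n} (X : Fin 4 → Fin 4 → Matrix n) {v : Vector (4 ℕ.* n)} (w : Fin 4 → Vector n) →
              (∀ b q → v (combine b q) ≈ w b q) → ∀ a p →
              (block4 X ·ᵥ v) (combine a p) ≈ Σ[ (λ b → (X a b ·ᵥ w b) p) ]
  block4-·ᵥ {n} X {v} w v≈w a p = begin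
    Σ[ (λ r → block4 X (combine a p) r * v r) ]
      ≈⟨ Σ-combine 4 {n} (λ r → block4 X (combine a p) r * v r) ⟩
    Σ[ (λ (b : Fin 4) → Σ[ (λ (q : Fin n) → block4 X (combine a p) (combine b q) * v (combine b q)) ]) ]
      ≈⟨ Σ-cong {4} (λ b → Σ-cong {n} (λ q → *-cong (reflexive (block4-combine X a b p q)) (v≈w b q))) ⟩
    Σ[ (λ b → (X a b ·ᵥ w b) p) ] ∎

  ≈ᵥ-combine : ∀ {m n} {u v : Vector (m ℕ.* n)} → (∀ a p → u (combine a p) ≈ v (combine a p)) → u ≈ᵥ v
  ≈ᵥ-combine {m} {n} {u} {v} u≈v r =
    ≡.subst (λ r → u r ≈ v r) (combine-remQuot {m} n r) (u≈v (proj₁ (remQuot {m} n r)) (proj₂ (remQuot {m} n r)))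

  doubleBlocks : ∀ {n} → Vector n → Vector n → Fin 4 → Vector n
  doubleBlocks x y zero          = x
  doubleBlocks x y (suc zero)    = x
  doubleBlocks x y (suc (suc _)) = y

  pattern4-eigenvector : ∀ {n} (P Q R S U W : Matrix n) {x y : Vector n} {Λ} →
    (∀ p → (P ·ᵥ x) p + (R ·ᵥ y) p ≈ Λ * x p) →
    (∀ p → (S ·ᵥ x) p + (U ·ᵥ y) p ≈ Λ * y p) →
    ∀ a p → Σ[ (λ b → (pattern4 P Q R S U W a b ·ᵥ doubleBlocks x y b) p) ] ≈ (Λ + Λ) * doubleBlocks x y a p
  pattern4-eigenvector P Q R S U W {x} {y} {Λ} top bottom = rows
    where
    open +-Solver using (solve; _⊕_; _⊜_; id)

    regroupᵗ : ∀ a b → (a + a) + (b + (b + 0#)) ≈ (a + b) + (a + b)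
    regroupᵗ = solve 2 (λ a b → (a ⊕ a) ⊕ (b ⊕ (b ⊕ id)) ⊜ (a ⊕ b) ⊕ (a ⊕ b)) refl

    regroupᵇ : ∀ a b → a + (a + ((b + b) + 0#)) ≈ (a + b) + (a + b)
    regroupᵇ = solve 2 (λ a b → a ⊕ (a ⊕ ((b ⊕ b) ⊕ id)) ⊜ (a ⊕ b) ⊕ (a ⊕ b)) refl

    twice : ∀ {z w} → z ≈ Λ * w → z + z ≈ (Λ + Λ) * w
    twice {w = w} z≈Λw = trans (+-cong z≈Λw z≈Λw) (sym (distribʳ w Λ Λ))

    rows : ∀ a p → Σ[ (λ b → (pattern4 P Q R S U W a b ·ᵥ doubleBlocks x y b) p) ] ≈ (Λ + Λ) * doubleBlocks x y a p
    rows zero p = begin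
      ((P +ₘ Q) ·ᵥ x) p + (((P -ₘ Q) ·ᵥ x) p + ((R ·ᵥ y) p + ((R ·ᵥ y) p + 0#)))
        ≈⟨ +-cong (+ₘ-·ᵥ P Q x p) (+-congʳ (-ₘ-·ᵥ P Q x p)) ⟩
      ((P ·ᵥ x) p + (Q ·ᵥ x) p) + (((P ·ᵥ x) p - (Q ·ᵥ x) p) + ((R ·ᵥ y) p + ((R ·ᵥ y) p + 0#)))
        ≈⟨ +-cancel-pair (-‿inverseʳ _) ⟩
      ((P ·ᵥ x) p + (P ·ᵥ x) p) + ((R ·ᵥ y) p + ((R ·ᵥ y) p + 0#))
        ≈⟨ trans (regroupᵗ _ _) (twice (top p)) ⟩
      (Λ + Λ) * x p ∎
    rows (suc zero) p = begin
      ((P -ₘ Q) ·ᵥ x) p + (((P +ₘ Q) ·ᵥ x) p + ((R ·ᵥ y) p + ((R ·ᵥ y) p + 0#)))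
        ≈⟨ +-cong (-ₘ-·ᵥ P Q x p) (+-congʳ (+ₘ-·ᵥ P Q x p)) ⟩
      ((P ·ᵥ x) p - (Q ·ᵥ x) p) + (((P ·ᵥ x) p + (Q ·ᵥ x) p) + ((R ·ᵥ y) p + ((R ·ᵥ y) p + 0#)))
        ≈⟨ +-cancel-pair (-‿inverseˡ _) ⟩
      ((P ·ᵥ x) p + (P ·ᵥ x) p) + ((R ·ᵥ y) p + ((R ·ᵥ y) p + 0#))
        ≈⟨ trans (regroupᵗ _ _) (twice (top p)) ⟩
      (Λ + Λ) * x p ∎
    rows (suc (suc zero)) p = begin
      (S ·ᵥ x) p + ((S ·ᵥ x) p + (((U +ₘ W) ·ᵥ y) p + (((U -ₘ W) ·ᵥ y) p + 0#)))
        ≈⟨ +-congˡ (+-congˡ (+-cong (+ₘ-·ᵥ U W y p) (+-congʳ (-ₘ-·ᵥ U W y p)))) ⟩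
      (S ·ᵥ x) p + ((S ·ᵥ x) p + (((U ·ᵥ y) p + (W ·ᵥ y) p) + (((U ·ᵥ y) p - (W ·ᵥ y) p) + 0#)))
        ≈⟨ +-congˡ (+-congˡ (+-cancel-pair (-‿inverseʳ _))) ⟩
      (S ·ᵥ x) p + ((S ·ᵥ x) p + (((U ·ᵥ y) p + (U ·ᵥ y) p) + 0#))
        ≈⟨ trans (regroupᵇ _ _) (twice (bottom p)) ⟩
      (Λ + Λ) * y p ∎
    rows (suc (suc (suc zero))) p = begin
      (S ·ᵥ x) p + ((S ·ᵥ x) p + (((U -ₘ W) ·ᵥ y) p + (((U +ₘ W) ·ᵥ y) p + 0#)))
        ≈⟨ +-congˡ (+-congˡ (+-cong (-ₘ-·ᵥ U W y p) (+-congʳ (+ₘ-·ᵥ U W y p)))) ⟩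
      (S ·ᵥ x) p + ((S ·ᵥ x) p + (((U ·ᵥ y) p - (W ·ᵥ y) p) + (((U ·ᵥ y) p + (W ·ᵥ y) p) + 0#)))
        ≈⟨ +-congˡ (+-congˡ (+-cancel-pair (-‿inverseˡ _))) ⟩
      (S ·ᵥ x) p + ((S ·ᵥ x) p + (((U ·ᵥ y) p + (U ·ᵥ y) p) + 0#))
        ≈⟨ trans (regroupᵇ _ _) (twice (bottom p)) ⟩
      (Λ + Λ) * y p ∎

module JonesPairs {c ℓ} (𝔽 : ACF0 c ℓ) where
  open ACF0 𝔽
  open Matrices 𝔽

  module SymmetricJonesPair {n : ℕ} (i₀ : Fin n) (A B A⁻¹ B⁻¹ : Matrix n)
    (A⊗A⁻¹≈I : (A ⊗ A⁻¹) ≈ₘ I) (A⁻¹⊗A≈I : (A⁻¹ ⊗ A) ≈ₘ I)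
    (B⊗B⁻¹≈I : (B ⊗ B⁻¹) ≈ₘ I) (B⁻¹⊗B≈I : (B⁻¹ ⊗ B) ≈ₘ I)
    (A≉0 : NoZeroEntry A) (B≉0 : NoZeroEntry B) (A-sym : Symmetric A)
    (jones : ∀ M → (A ⊗ (B ∘ₘ (A ⊗ M))) ≈ₘ (B ∘ₘ (A ⊗ (B ∘ₘ M))))
    (jonesᵀ : ∀ M → (A ⊗ ((B ᵀ) ∘ₘ (A ⊗ M))) ≈ₘ ((B ᵀ) ∘ₘ (A ⊗ ((B ᵀ) ∘ₘ M))))
    where

    open FieldProperties 𝔽
    open Summation 𝔽
    open MatrixAlgebra 𝔽
    open NomuraAlgebras 𝔽
    open BlockMatrices 𝔽
    open SetoidReasoning setoid

    n# : Carrier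
    n# = fromℕ n

    n#≉0 : n# ≉ 0#
    n#≉0 = fromℕ≉0 i₀

    -- A and B are type II

    Θ[A,B]A≈B : ΘRel A B A B
    Θ[A,B]A≈B = jones⇒ΘRel jones

    Θ[A,Bᵀ]A≈Bᵀ : ΘRel A (B ᵀ) A (B ᵀ)
    Θ[A,Bᵀ]A≈Bᵀ = jones⇒ΘRel jonesᵀ

    A⁻¹-sym : Symmetric A⁻¹
    A⁻¹-sym = inverse-symmetric A-sym A⊗A⁻¹≈I

    ρ : Fin n → Fin n → Carrier
    ρ i t = A i t * A⁻¹ t i

    ρ-row-sum : ∀ i → Σ[ ρ i ] ≈ 1#
    ρ-row-sum i = trans (A⊗A⁻¹≈I i i) (I-diag i)

    ρ-col-sum : ∀ t → Σ[ (λ i → ρ i t) ] ≈ 1#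
    ρ-col-sum t = trans (Σ-cong (λ i → *-comm (A i t) (A⁻¹ t i))) (trans (A⁻¹⊗A≈I t t) (I-diag t))

    ρ*B-row-sum : ∀ i q → Σ[ (λ j → ρ i j * B j q) ] ≈ A i i
    ρ*B-row-sum i q = begin
      Σ[ (λ j → (A i j * A⁻¹ j i) * B j q) ]
        ≈⟨ Σ-cong (λ j → trans (*-congʳ (trans (*-comm _ _) (*-cong (sym (A⁻¹-sym j i)) (A-sym j i))))
                               (*-assoc _ _ _)) ⟩
      Σ[ (λ j → A⁻¹ i j * (A j i * B j q)) ]
        ≈⟨ ΘRel-inverse A⁻¹⊗A≈I B≉0 Θ[A,B]A≈B i q i ⟩
      B i q ⁻¹ * (A i i * B i q)
        ≈⟨ x∙yz≈y∙xz _ _ _ ⟩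
      A i i * (B i q ⁻¹ * B i q)
        ≈⟨ trans (*-congˡ (x⁻¹*x≈1 (B≉0 i q))) (*-identityʳ _) ⟩
      A i i ∎

    z : Fin n → Carrier
    z t = Σ[ (λ q → B⁻¹ q t) ]

    ρ≈Aᵢᵢ*z : ∀ i t → ρ i t ≈ A i i * z t
    ρ≈Aᵢᵢ*z i t = begin
      ρ i t                                               ≈⟨ Σ-*I (ρ i) t ⟨
      Σ[ (λ j → ρ i j * I j t) ]                          ≈⟨ Σ-cong (λ j → *-congˡ (B⊗B⁻¹≈I j t)) ⟨
      Σ[ (λ j → ρ i j * (B ⊗ B⁻¹) j t) ]                  ≈⟨ Σ-assoc (ρ i) B (λ q → B⁻¹ q t) ⟨
      Σ[ (λ q → Σ[ (λ j → ρ i j * B j q) ] * B⁻¹ q t) ]   ≈⟨ Σ-cong (λ q → *-congʳ (ρ*B-row-sum i q)) ⟩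
      Σ[ (λ q → A i i * B⁻¹ q t) ]                        ≈⟨ *-distribˡ-Σ (A i i) (λ q → B⁻¹ q t) ⟩
      A i i * z t                                         ∎

    -- z t is the inverse of the trace of A, hence independent of t.
    z*trace≈1 : ∀ t → z t * Σ[ (λ i → A i i) ] ≈ 1#
    z*trace≈1 t = begin
      z t * Σ[ (λ i → A i i) ]     ≈⟨ *-distribˡ-Σ (z t) (λ i → A i i) ⟨
      Σ[ (λ i → z t * A i i) ]     ≈⟨ Σ-cong (λ i → trans (*-comm _ _) (sym (ρ≈Aᵢᵢ*z i t))) ⟩
      Σ[ (λ i → ρ i t) ]           ≈⟨ ρ-col-sum t ⟩
      1#                           ∎

    z-const : ∀ t t′ → z t ≈ z t′
    z-const t t′ = begin
      z t                           ≈⟨ *-identityʳ _ ⟨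
      z t * 1#                      ≈⟨ *-congˡ (z*trace≈1 t′) ⟨
      z t * (z t′ * tr)             ≈⟨ x∙yz≈y∙xz _ _ _ ⟩
      z t′ * (z t * tr)             ≈⟨ *-congˡ (z*trace≈1 t) ⟩
      z t′ * 1#                     ≈⟨ *-identityʳ _ ⟩
      z t′                          ∎
      where tr = Σ[ (λ i → A i i) ]

    n*ρ≈1 : ∀ i t → n# * ρ i t ≈ 1#
    n*ρ≈1 i t = begin
      n# * ρ i t
        ≈⟨ Σ-const {n} (ρ i t) ⟨
      Σ[ (λ (_ : Fin n) → ρ i t) ]
        ≈⟨ Σ-cong (λ t′ → trans (ρ≈Aᵢᵢ*z i t) (trans (*-congˡ (z-const t t′)) (sym (ρ≈Aᵢᵢ*z i t′)))) ⟩
      Σ[ ρ i ]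
        ≈⟨ ρ-row-sum i ⟩
      1# ∎

    A⁻¹-entry : ∀ i t → A i t ⁻¹ ≈ n# * A⁻¹ t i
    A⁻¹-entry i t = sym (⁻¹-unique (A≉0 i t) (trans (x∙yz≈y∙xz (A i t) n# (A⁻¹ t i)) (n*ρ≈1 i t)))

    A-typeII : TypeII A
    A-typeII = typeII-from-inverse A≉0 A⊗A⁻¹≈I A⁻¹-entry

    α β β′ : Fin n → Fin n → Vector n
    α i j = col A i ∘ᵥ col (A ⁽⁻⁾) j
    β i j = col (B ⁽⁻⁾) i ∘ᵥ col B j
    β′ i j = col ((B ⁽⁻⁾) ᵀ) i ∘ᵥ col (B ᵀ) j

    B·α : ∀ i j → (B ·ᵥ α i j) ≈ᵥ ((n# * A j i) ∙ᵥ β i j)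
    B·α i j a = begin
      Σ[ (λ b → B a b * (A b i * A b j ⁻¹)) ]
        ≈⟨ Σ-cong (λ b → *-congˡ (*-congˡ (A⁻¹-entry b j))) ⟩
      Σ[ (λ b → B a b * (A b i * (n# * A⁻¹ j b))) ]
        ≈⟨ Σ-cong (λ b → solve 4 (λ x y m z → x ⊕ (y ⊕ (m ⊕ z)) ⊜ m ⊕ (z ⊕ (y ⊕ x)))
                                 refl (B a b) (A b i) n# (A⁻¹ j b)) ⟩
      Σ[ (λ b → n# * (A⁻¹ j b * (A b i * B a b))) ]
        ≈⟨ *-distribˡ-Σ n# (λ b → A⁻¹ j b * (A b i * B a b)) ⟩
      n# * Σ[ (λ b → A⁻¹ j b * (A b i * B a b)) ]
        ≈⟨ *-congˡ (ΘRel-inverse A⁻¹⊗A≈I (λ i j → B≉0 j i) Θ[A,Bᵀ]A≈Bᵀ i a j) ⟩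
      n# * (B a i ⁻¹ * (A j i * B a j))
        ≈⟨ solve 4 (λ m x y z → m ⊕ (x ⊕ (y ⊕ z)) ⊜ (m ⊕ y) ⊕ (x ⊕ z)) refl n# (B a i ⁻¹) (A j i) (B a j) ⟩
      (n# * A j i) * (B a i ⁻¹ * B a j) ∎
      where open *-Solver using (solve; _⊕_; _⊜_)

    B-col-sum : ∀ q → Σ[ (λ j → B j q) ] ≈ n# * A i₀ i₀
    B-col-sum q = begin
      Σ[ (λ j → B j q) ]
        ≈⟨ Σ-cong (λ j → trans (sym (*-identityˡ _)) (*-congʳ (sym (n*ρ≈1 i₀ j)))) ⟩
      Σ[ (λ j → (n# * ρ i₀ j) * B j q) ]
        ≈⟨ Σ-cong (λ j → *-assoc n# (ρ i₀ j) (B j q)) ⟩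
      Σ[ (λ j → n# * (ρ i₀ j * B j q)) ]
        ≈⟨ *-distribˡ-Σ n# (λ j → ρ i₀ j * B j q) ⟩
      n# * Σ[ (λ j → ρ i₀ j * B j q) ]
        ≈⟨ *-congˡ (ρ*B-row-sum i₀ q) ⟩
      n# * A i₀ i₀ ∎

    Σα : ∀ y k → Σ[ α y k ] ≈ n# * I y k
    Σα y k = trans (Σ-cong (λ c → *-cong (sym (A-sym c y)) (⁻¹-cong (A≉0 c k) (sym (A-sym c k)))))
                   (proj₂ A-typeII y k)

    Σβ-scaled : ∀ y k → (n# * A k y) * Σ[ β y k ] ≈ (n# * A i₀ i₀) * Σ[ α y k ]
    Σβ-scaled y k = begin
      (n# * A k y) * Σ[ β y k ]
        ≈⟨ *-distribˡ-Σ (n# * A k y) (β y k) ⟨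
      Σ[ (λ b → (n# * A k y) * β y k b) ]
        ≈⟨ Σ-cong (B·α y k) ⟨
      Σ[ (λ b → Σ[ (λ c → B b c * α y k c) ]) ]
        ≈⟨ Σ-comm (λ b c → B b c * α y k c) ⟩
      Σ[ (λ c → Σ[ (λ b → B b c * α y k c) ]) ]
        ≈⟨ Σ-cong (λ c → *-distribʳ-Σ (α y k c) (λ b → B b c)) ⟩
      Σ[ (λ c → Σ[ (λ b → B b c) ] * α y k c) ]
        ≈⟨ Σ-cong (λ c → *-congʳ (B-col-sum c)) ⟩
      Σ[ (λ c → (n# * A i₀ i₀) * α y k c) ]
        ≈⟨ *-distribˡ-Σ (n# * A i₀ i₀) (α y k) ⟩
      (n# * A i₀ i₀) * Σ[ α y k ] ∎

    Σβ : ∀ y k → Σ[ β y k ] ≈ n# * I y k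
    Σβ y k = by-cases (y Fin.≟ k)
      where
      by-cases : Dec (y ≡.≡ k) → Σ[ β y k ] ≈ n# * I y k
      by-cases (yes y≡k) = ≡.subst (λ k → Σ[ β y k ] ≈ n# * I y k) y≡k (begin
        Σ[ β y y ]                   ≈⟨ Σ-cong (λ b → x⁻¹*x≈1 (B≉0 b y)) ⟩
        Σ[ (λ (_ : Fin n) → 1#) ]    ≈⟨ Σ-const {n} 1# ⟩
        n# * 1#                      ≈⟨ *-congˡ (I-diag y) ⟨
        n# * I y y                   ∎)
      by-cases (no y≢k) = trans
        (x*y≈0⇒y≈0 (x≉0∧y≉0⇒x*y≉0 n#≉0 (A≉0 k y))
          (trans (Σβ-scaled y k) (trans (*-congˡ (trans (Σα y k) n*Iyk≈0)) (zeroʳ _))))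
        (sym n*Iyk≈0)
        where
        n*Iyk≈0 : n# * I y k ≈ 0#
        n*Iyk≈0 = trans (*-congˡ (I-offdiag y≢k)) (zeroʳ n#)

    B⁻¹-entry : ∀ t y → B t y ⁻¹ ≈ n# * B⁻¹ y t
    B⁻¹-entry t y = begin
      B t y ⁻¹
        ≈⟨ Σ-*I (λ b → B b y ⁻¹) t ⟨
      Σ[ (λ b → B b y ⁻¹ * I b t) ]
        ≈⟨ Σ-cong (λ b → *-congˡ (B⊗B⁻¹≈I b t)) ⟨
      Σ[ (λ b → B b y ⁻¹ * (B ⊗ B⁻¹) b t) ]
        ≈⟨ Σ-assoc (λ b → B b y ⁻¹) B (λ k → B⁻¹ k t) ⟨
      Σ[ (λ k → Σ[ β y k ] * B⁻¹ k t) ]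
        ≈⟨ Σ-cong (λ k → trans (*-congʳ (Σβ y k)) (*-assoc _ _ _)) ⟩
      Σ[ (λ k → n# * (I y k * B⁻¹ k t)) ]
        ≈⟨ *-distribˡ-Σ n# (λ k → I y k * B⁻¹ k t) ⟩
      n# * Σ[ (λ k → I y k * B⁻¹ k t) ]
        ≈⟨ *-congˡ (Σ-I* (λ k → B⁻¹ k t) y) ⟩
      n# * B⁻¹ y t ∎

    B-typeII : TypeII B
    B-typeII = typeII-from-inverse B≉0 B⊗B⁻¹≈I B⁻¹-entry

    Bᵀ-typeII : TypeII (B ᵀ)
    Bᵀ-typeII = typeII-from-inverse (λ i j → B≉0 j i) (ᵀ-inverse B⁻¹⊗B≈I) (λ i t → B⁻¹-entry t i)

    A⁽⁻⁾-typeII : TypeII (A ⁽⁻⁾)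
    A⁽⁻⁾-typeII = typeII-⁽⁻⁾ A-typeII

    -- Θ_A and conjugation by B

    α-flip : ∀ i j a → A j a ⁻¹ * A i a ≈ α i j a
    α-flip i j a = trans (*-comm _ _) (*-cong (A-sym a i) (⁻¹-cong (A≉0 j a) (sym (A-sym j a))))

    Θ[A]-dual : ∀ {X ξ} → ΘRel A (A ⁽⁻⁾) X ξ → ΘRel A (A ⁽⁻⁾) ξ (λ y k → n# * X k y)
    Θ[A]-dual ΘX y k =
      ·ᵥ-image-cong (λ b → trans (*-congˡ (⁻¹-involutive (A≉0 y b))) (α-flip y k b)) (α-flip y k)
      (Θ-exchange A≉0 (proj₂ A⁽⁻⁾-typeII) ΘX k y)

    Θ[A]-transpose : ∀ {X ξ} → ΘRel A (A ⁽⁻⁾) X ξ → ΘRel A (A ⁽⁻⁾) (X ᵀ) (ξ ᵀ)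
    Θ[A]-transpose ΘX = ΘRel-cancel n#≉0 (Θ[A]-dual (Θ[A]-dual ΘX))

    Θ[A]-injective : ∀ {X X′ ξ} → ΘRel A (A ⁽⁻⁾) X ξ → ΘRel A (A ⁽⁻⁾) X′ ξ → X ≈ₘ X′
    Θ[A]-injective ΘX ΘX′ k y =
      *-cancelˡ n#≉0 (ΘRel-unique A≉0 (proj₁ A⁽⁻⁾-typeII) i₀ (Θ[A]-dual ΘX) (Θ[A]-dual ΘX′) y k)

    Θ[A,B]-exchange : ∀ {M Θ} → ΘRel A B M Θ → ∀ i j → (Θ ·ᵥ β′ i j) ≈ᵥ ((n# * M j i) ∙ᵥ α i j)
    Θ[A,B]-exchange ΘM i j = ·ᵥ-image-cong (λ b → *-comm _ _) (α-flip i j)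
      (Θ-exchange A≉0 (proj₂ B-typeII) ΘM j i)

    B·β′ : ∀ i j → (B ·ᵥ β′ i j) ≈ᵥ ((n# * A j i) ∙ᵥ α i j)
    B·β′ = Θ[A,B]-exchange Θ[A,B]A≈B

    Bᵀ·β : ∀ i j → ((B ᵀ) ·ᵥ β i j) ≈ᵥ ((n# * A j i) ∙ᵥ α i j)
    Bᵀ·β i j = ·ᵥ-image-cong (λ b → *-comm _ _) (α-flip i j)
      (Θ-exchange A≉0 (proj₂ Bᵀ-typeII) Θ[A,Bᵀ]A≈Bᵀ j i)

    conjB : Matrix n → Matrix n
    conjB W = B⁻¹ ⊗ (W ⊗ B)

    Θ[A]⇒Θ[B⁽⁻⁾ᵀ,Bᵀ] : ∀ {W θ} → ΘRel A (A ⁽⁻⁾) W θ → ΘRel ((B ⁽⁻⁾) ᵀ) (B ᵀ) (conjB W) θ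
    Θ[A]⇒Θ[B⁽⁻⁾ᵀ,Bᵀ] ΘW i j = eigenvector-conjugate B⁻¹⊗B≈I (B·β′ i j) (ΘW i j)

    Θ[A]·β : ∀ {W θ} → ΘRel A (A ⁽⁻⁾) W θ → ∀ i j → (θ ·ᵥ β i j) ≈ᵥ ((n# * conjB W j i) ∙ᵥ β i j)
    Θ[A]·β ΘW i j =
      ·ᵥ-image-cong (λ b → *-comm _ _) (λ a → trans (*-comm _ _) (*-congˡ (⁻¹-involutive (B≉0 a j))))
      (Θ-exchange (λ a b → x⁻¹≉0 (B≉0 b a)) (proj₂ Bᵀ-typeII) (Θ[A]⇒Θ[B⁽⁻⁾ᵀ,Bᵀ] ΘW) j i)

    Θ[B⁽⁻⁾]⇒Θ[A] : ∀ {F S} → ΘRel (B ⁽⁻⁾) ((B ⁽⁻⁾) ⁽⁻⁾) F S → ΘRel A (A ⁽⁻⁾) (conjB F) S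
    Θ[B⁽⁻⁾]⇒Θ[A] ΘF i j = eigenvector-conjugate B⁻¹⊗B≈I (B·α i j)
      (·ᵥ-image-cong w≈β w≈β (ΘF i j))
      where
      w≈β : (col (B ⁽⁻⁾) i ∘ᵥ col ((B ⁽⁻⁾) ⁽⁻⁾) j) ≈ᵥ β i j
      w≈β b = *-congˡ (⁻¹-involutive (B≉0 b j))

    -- n X is the Θ_A-image of ξᵀ.
    N[A]⊆N[B⁽⁻⁾] : ∀ {X ξ} → ΘRel A (A ⁽⁻⁾) X ξ → ∀ i j → (X ·ᵥ β i j) ≈ᵥ (conjB (ξ ᵀ) j i ∙ᵥ β i j)
    N[A]⊆N[B⁽⁻⁾] {X} {ξ} ΘX i j a = *-cancelˡ n#≉0 (begin
      n# * (X ·ᵥ β i j) a                      ≈⟨ ∙ₘ-·ᵥ n# X (β i j) a ⟨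
      ((n# ∙ₘ X) ·ᵥ β i j) a                   ≈⟨ Θ[A]·β (Θ[A]-dual (Θ[A]-transpose ΘX)) i j a ⟩
      (n# * conjB (ξ ᵀ) j i) * β i j a         ≈⟨ *-assoc _ _ _ ⟩
      n# * (conjB (ξ ᵀ) j i * β i j a)         ∎)

    -- The eigenvalue relations

    Θ[A,B]⊗B⁻¹∈N[A] : ∀ {M Θ} → ΘRel A B M Θ →
                      ΘRel A (A ⁽⁻⁾) (Θ ⊗ B⁻¹) (λ i j → (n# * A j i) ⁻¹ * (n# * M j i))
    Θ[A,B]⊗B⁻¹∈N[A] {M} {Θ} ΘM i j a =
      trans (x*y≈z⇒y≈x⁻¹*z (x≉0∧y≉0⇒x*y≉0 n#≉0 (A≉0 j i)) (begin
      (n# * A j i) * ((Θ ⊗ B⁻¹) ·ᵥ α i j) a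
        ≈⟨ *-congˡ (⊗-·ᵥ Θ B⁻¹ (α i j) a) ⟩
      (n# * A j i) * (Θ ·ᵥ (B⁻¹ ·ᵥ α i j)) a
        ≈⟨ ·ᵥ-∙ᵥ Θ _ (B⁻¹ ·ᵥ α i j) a ⟨
      (Θ ·ᵥ ((n# * A j i) ∙ᵥ (B⁻¹ ·ᵥ α i j))) a
        ≈⟨ ·ᵥ-congʳ Θ (·ᵥ-invert B⁻¹⊗B≈I (B·β′ i j)) a ⟩
      (Θ ·ᵥ β′ i j) a
        ≈⟨ Θ[A,B]-exchange ΘM i j a ⟩
      (n# * M j i) * α i j a ∎)) (sym (*-assoc _ _ _))

    module Θ-of-G {G PΘ QΘ} (ΘG : ΘRel A B G PΘ) (ΘGᵀ : ΘRel A B (G ᵀ) QΘ) where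

      ξ : Matrix n
      ξ i j = (n# * A j i) ⁻¹ * (n# * G j i)

      PΘ⊗B⁻¹≈[QΘ⊗B⁻¹]ᵀ : (PΘ ⊗ B⁻¹) ≈ₘ ((QΘ ⊗ B⁻¹) ᵀ)
      PΘ⊗B⁻¹≈[QΘ⊗B⁻¹]ᵀ = Θ[A]-injective (Θ[A,B]⊗B⁻¹∈N[A] ΘG) (λ i j a →
        trans (Θ[A]-transpose (Θ[A,B]⊗B⁻¹∈N[A] ΘGᵀ) i j a)
              (*-congʳ (*-congʳ (⁻¹-cong (x≉0∧y≉0⇒x*y≉0 n#≉0 (A≉0 i j)) (*-congˡ (A-sym j i))))))

      μ : Fin n → Fin n → Carrier
      μ i j = (n# * A j i) * conjB (ξ ᵀ) j i

      PΘ·α : ∀ i j → (PΘ ·ᵥ α i j) ≈ᵥ (μ i j ∙ᵥ β i j)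
      PΘ·α i j a = begin
        (PΘ ·ᵥ α i j) a
          ≈⟨ ·ᵥ-congʳ PΘ (·ᵥ-invert B⁻¹⊗B≈I (B·α i j)) a ⟨
        (PΘ ·ᵥ ((n# * A j i) ∙ᵥ (B⁻¹ ·ᵥ β i j))) a
          ≈⟨ ·ᵥ-∙ᵥ PΘ _ (B⁻¹ ·ᵥ β i j) a ⟩
        (n# * A j i) * (PΘ ·ᵥ (B⁻¹ ·ᵥ β i j)) a
          ≈⟨ *-congˡ (⊗-·ᵥ PΘ B⁻¹ (β i j) a) ⟨
        (n# * A j i) * ((PΘ ⊗ B⁻¹) ·ᵥ β i j) a
          ≈⟨ *-congˡ (N[A]⊆N[B⁽⁻⁾] (Θ[A,B]⊗B⁻¹∈N[A] ΘG) i j a) ⟩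
        (n# * A j i) * (conjB (ξ ᵀ) j i * β i j a)
          ≈⟨ *-assoc _ _ _ ⟨
        μ i j * β i j a ∎

      QΘᵀ·β : ∀ i j → ((QΘ ᵀ) ·ᵥ β i j) ≈ᵥ (μ i j ∙ᵥ α i j)
      QΘᵀ·β i j a = begin
        ((QΘ ᵀ) ·ᵥ β i j) a
          ≈⟨ ·ᵥ-congˡ (β i j) (ᵀ-⊗-inverse QΘ B⁻¹⊗B≈I) a ⟨
        (((B ᵀ) ⊗ ((QΘ ⊗ B⁻¹) ᵀ)) ·ᵥ β i j) a
          ≈⟨ ⊗-·ᵥ (B ᵀ) ((QΘ ⊗ B⁻¹) ᵀ) (β i j) a ⟩
        ((B ᵀ) ·ᵥ (((QΘ ⊗ B⁻¹) ᵀ) ·ᵥ β i j)) a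
          ≈⟨ ·ᵥ-congʳ (B ᵀ) (·ᵥ-congˡ (β i j) PΘ⊗B⁻¹≈[QΘ⊗B⁻¹]ᵀ) a ⟨
        ((B ᵀ) ·ᵥ ((PΘ ⊗ B⁻¹) ·ᵥ β i j)) a
          ≈⟨ ·ᵥ-congʳ (B ᵀ) (N[A]⊆N[B⁽⁻⁾] (Θ[A,B]⊗B⁻¹∈N[A] ΘG) i j) a ⟩
        ((B ᵀ) ·ᵥ (conjB (ξ ᵀ) j i ∙ᵥ β i j)) a
          ≈⟨ ·ᵥ-∙ᵥ (B ᵀ) _ (β i j) a ⟩
        conjB (ξ ᵀ) j i * ((B ᵀ) ·ᵥ β i j) a
          ≈⟨ *-congˡ (Bᵀ·β i j a) ⟩
        conjB (ξ ᵀ) j i * ((n# * A j i) * α i j a)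
          ≈⟨ x∙yz≈yx∙z _ _ _ ⟩
        μ i j * α i j a ∎

    module Θ-of-F {F T S} (ΘF : ΘRel A (A ⁽⁻⁾) F T) (ΘF′ : ΘRel (B ⁽⁻⁾) ((B ⁽⁻⁾) ⁽⁻⁾) F S) where

      λ₀ : Fin n → Fin n → Carrier
      λ₀ i j = n# * conjB F j i

      T·β : ∀ i j → (T ·ᵥ β i j) ≈ᵥ (λ₀ i j ∙ᵥ β i j)
      T·β = Θ[A]·β ΘF

      S·α : ∀ i j → (S ·ᵥ α i j) ≈ᵥ (λ₀ i j ∙ᵥ α i j)
      S·α = Θ[A]-dual (Θ[B⁽⁻⁾]⇒Θ[A] ΘF′)

    module Eigenvalue {F G T S PΘ QΘ} (ΘF : ΘRel A (A ⁽⁻⁾) F T) (ΘF′ : ΘRel (B ⁽⁻⁾) ((B ⁽⁻⁾) ⁽⁻⁾) F S)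
      (ΘG : ΘRel A B G PΘ) (ΘGᵀ : ΘRel A B (G ᵀ) QΘ) {σ} (σ*σ≈1 : σ * σ ≈ 1#) (i j : Fin n) where

      open Θ-of-F ΘF ΘF′
      open Θ-of-G ΘG ΘGᵀ

      Λ : Carrier
      Λ = λ₀ i j + σ * μ i j

      T·β+PΘ·σα : ∀ p → (T ·ᵥ β i j) p + (PΘ ·ᵥ (σ ∙ᵥ α i j)) p ≈ Λ * β i j p
      T·β+PΘ·σα p = begin
        (T ·ᵥ β i j) p + (PΘ ·ᵥ (σ ∙ᵥ α i j)) p
          ≈⟨ +-cong (T·β i j p) (trans (·ᵥ-∙ᵥ PΘ σ (α i j) p) (*-congˡ (PΘ·α i j p))) ⟩
        λ₀ i j * β i j p + σ * (μ i j * β i j p)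
          ≈⟨ +-congˡ (*-assoc σ (μ i j) (β i j p)) ⟨
        λ₀ i j * β i j p + (σ * μ i j) * β i j p
          ≈⟨ distribʳ (β i j p) (λ₀ i j) (σ * μ i j) ⟨
        Λ * β i j p ∎

      QΘᵀ·β+S·σα : ∀ p → ((QΘ ᵀ) ·ᵥ β i j) p + (S ·ᵥ (σ ∙ᵥ α i j)) p ≈ Λ * (σ * α i j p)
      QΘᵀ·β+S·σα p = begin
        ((QΘ ᵀ) ·ᵥ β i j) p + (S ·ᵥ (σ ∙ᵥ α i j)) p
          ≈⟨ +-cong (QΘᵀ·β i j p) (trans (·ᵥ-∙ᵥ S σ (α i j) p) (*-congˡ (S·α i j p))) ⟩
        μ i j * α i j p + σ * (λ₀ i j * α i j p)
          ≈⟨ +-comm _ _ ⟩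
        σ * (λ₀ i j * α i j p) + μ i j * α i j p
          ≈⟨ +-cong (x∙yz≈y∙xz (λ₀ i j) σ (α i j p)) σσμα≈μα ⟨
        λ₀ i j * (σ * α i j p) + (σ * μ i j) * (σ * α i j p)
                                                       ≈⟨ distribʳ (σ * α i j p) (λ₀ i j) (σ * μ i j) ⟨
        Λ * (σ * α i j p) ∎
        where
        σσμα≈μα : (σ * μ i j) * (σ * α i j p) ≈ μ i j * α i j p
        σσμα≈μα = begin
          (σ * μ i j) * (σ * α i j p)   ≈⟨ interchange σ (μ i j) σ (α i j p) ⟩
          (σ * σ) * (μ i j * α i j p)   ≈⟨ *-congʳ σ*σ≈1 ⟩
          1# * (μ i j * α i j p)        ≈⟨ *-identityˡ _ ⟩
          μ i j * α i j p               ∎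

    module _ (d : Carrier) (d≉0 : d ≉ 0#) where

      V : Matrix (4 ℕ.* n)
      V = Vmat d A B

      Vblocks-lower : ∀ e c q k → Vblocks d A B (suc (suc e)) (suc (suc c)) q k ≈ (sign e * sign c) * (d * A q k)
      Vblocks-lower zero       zero       q k = sym (trans (*-congʳ (*-identityˡ 1#)) (*-identityˡ _))
      Vblocks-lower zero       (suc zero) q k = sym (trans (*-congʳ (*-identityˡ _)) (-1*x≈-x _))
      Vblocks-lower (suc zero) zero       q k = sym (trans (*-congʳ (*-identityʳ _)) (-1*x≈-x _))
      Vblocks-lower (suc zero) (suc zero) q k = sym (trans (*-congʳ (sign*sign≈1 (suc zero))) (*-identityˡ _))

      Vblocks-ratio : ∀ i j c c′ b q →
        Vblocks d A B b (suc (suc c)) q i * Vblocks d A B b (suc (suc c′)) q j ⁻¹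
          ≈ doubleBlocks (β i j) ((sign c * sign c′) ∙ᵥ α i j) b q
      Vblocks-ratio i j c c′ zero          q = *-congˡ (⁻¹-involutive (B≉0 q j))
      Vblocks-ratio i j c c′ (suc zero)    q = *-congˡ (⁻¹-involutive (B≉0 q j))
      Vblocks-ratio i j c c′ (suc (suc e)) q = trans
        (*-cong (Vblocks-lower e c q i) (⁻¹-cong′ denominator≉0 (Vblocks-lower e c′ q j)))
        (signed-ratio e c c′ d≉0 (A≉0 q j))
        where
        denominator≉0 : (sign e * sign c′) * (d * A q j) ≉ 0#
        denominator≉0 = x≉0∧y≉0⇒x*y≉0 (x*x≈1⇒x≉0 (signs*signs≈1 e c′)) (x≉0∧y≉0⇒x*y≉0 d≉0 (A≉0 q j))

      V-column-ratio : ∀ c c′ i j b q →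
        (col V (combine (suc (suc c)) i) ∘ᵥ col (V ⁽⁻⁾) (combine (suc (suc c′)) j)) (combine b q)
          ≈ doubleBlocks (β i j) ((sign c * sign c′) ∙ᵥ α i j) b q
      V-column-ratio c c′ i j b q = trans
        (reflexive (≡.cong₂ (λ x y → x * y ⁻¹) (block4-combine (Vblocks d A B) b _ q i)
                                              (block4-combine (Vblocks d A B) b _ q j)))
        (Vblocks-ratio i j c c′ b q)

      lower-half-eigenvector :
        ∀ {F G H K T S PΘ QΘ} → ΘRel A (A ⁽⁻⁾) F T → ΘRel (B ⁽⁻⁾) ((B ⁽⁻⁾) ⁽⁻⁾) F S →
        ΘRel A B G PΘ → ΘRel A B (G ᵀ) QΘ →
        ∀ {M : Matrix (4 ℕ.* n)} → (∀ r s → M r s ≈ block4 (pattern4 T H PΘ (QΘ ᵀ) S K) r s) →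
        ∀ c c′ i j →
        IsEigenvector M (col V (combine (suc (suc c)) i) ∘ᵥ col (V ⁽⁻⁾) (combine (suc (suc c′)) j))
      lower-half-eigenvector {H = H} {K} {T} {S} {PΘ} {QΘ} ΘF ΘF′ ΘG ΘGᵀ {M} M≈ c c′ i j =
        v≉0 , Λ + Λ , ≈ᵥ-combine eigen
        where
        open Eigenvalue ΘF ΘF′ ΘG ΘGᵀ (signs*signs≈1 c c′) i j

        v : Vector (4 ℕ.* n)
        v = col V (combine (suc (suc c)) i) ∘ᵥ col (V ⁽⁻⁾) (combine (suc (suc c′)) j)

        w : Fin 4 → Vector n
        w = doubleBlocks (β i j) ((sign c * sign c′) ∙ᵥ α i j)

        v≉0 : ¬ (∀ k → v k ≈ 0#)
        v≉0 v≈0 = x≉0∧y≉0⇒x*y≉0 (x⁻¹≉0 (B≉0 i i)) (B≉0 i j)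
          (trans (sym (V-column-ratio c c′ i j zero i)) (v≈0 (combine {4} zero i)))

        blocks : Fin 4 → Fin 4 → Matrix n
        blocks = pattern4 T H PΘ (QΘ ᵀ) S K

        eigen : ∀ a p → (M ·ᵥ v) (combine a p) ≈ (Λ + Λ) * v (combine a p)
        eigen a p = begin
          (M ·ᵥ v) (combine a p)               ≈⟨ ·ᵥ-congˡ v M≈ (combine a p) ⟩
          (block4 blocks ·ᵥ v) (combine a p)   ≈⟨ block4-·ᵥ blocks w (V-column-ratio c c′ i j) a p ⟩
          Σ[ (λ b → (blocks a b ·ᵥ w b) p) ]   ≈⟨ pattern4-eigenvector T H PΘ (QΘ ᵀ) S K T·β+PΘ·σα QΘᵀ·β+S·σα a p ⟩
          (Λ + Λ) * w a p                      ≈⟨ *-congˡ (V-column-ratio c c′ i j a p) ⟨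
          (Λ + Λ) * v (combine a p)            ∎

lower-half-block : ∀ {n} (a : Fin 4) (i : Fin n) → 2 ℕ.* n ℕ.≤ toℕ (combine a i) → ∃[ c ] a ≡.≡ suc (suc c)
lower-half-block (suc (suc c)) i _ = c , ≡.refl
lower-half-block {n} zero i 2n≤r =
  contradiction 2n≤r (ℕₚ.<⇒≱ (≡.subst (ℕ._< 2 ℕ.* n) (≡.sym toℕr≡i)
  (ℕₚ.<-≤-trans (toℕ<n i) (ℕₚ.m≤m+n n (n ℕ.+ 0)))))
  where
  toℕr≡i : toℕ (combine {4} zero i) ≡.≡ toℕ i
  toℕr≡i = ≡.trans (toℕ-combine {4} zero i) (≡.cong (ℕ._+ toℕ i) (ℕₚ.*-zeroʳ n))
lower-half-block {n} (suc zero) i 2n≤r =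
  contradiction 2n≤r (ℕₚ.<⇒≱ (≡.subst (ℕ._< 2 ℕ.* n) (≡.sym toℕr≡n+i)
  (ℕₚ.+-monoʳ-< n (ℕₚ.<-≤-trans (toℕ<n i) (ℕₚ.m≤m+n n 0)))))
  where
  toℕr≡n+i : toℕ (combine {4} (suc zero) i) ≡.≡ n ℕ.+ toℕ i
  toℕr≡n+i = ≡.trans (toℕ-combine {4} (suc zero) i) (≡.cong (ℕ._+ toℕ i) (ℕₚ.*-identityʳ n))

lower-half : ∀ {n} (r : Fin (4 ℕ.* n)) → 2 ℕ.* n ℕ.≤ toℕ r → ∃[ c ] ∃[ i ] r ≡.≡ combine (suc (suc c)) i
lower-half {n} r 2n≤r = proj₁ lower , i , ≡.trans r≡ai (≡.cong (λ a → combine a i) (proj₂ lower))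
  where
  a = proj₁ (remQuot {4} n r)
  i = proj₂ (remQuot {4} n r)
  r≡ai : r ≡.≡ combine a i
  r≡ai = ≡.sym (combine-remQuot {4} n r)
  lower = lower-half-block a i (≡.subst (λ r → 2 ℕ.* n ℕ.≤ toℕ r) r≡ai 2n≤r)

lemma7p3 : ∀ {c ℓ : Level} (𝔽 : ACF0 c ℓ) →
    let open ACF0 𝔽 in
    let open Matrices 𝔽 in
    (n : ℕ) (A B : Matrix n) →
    InvertibleJonesPair A B → Symmetric A →
    (d : Carrier) → (d * d) ≈ fromℕ n →
    (M : Matrix (4 ℕ.* n)) → InCalB A B M →
    (r s : Fin (4 ℕ.* n)) → 2 ℕ.* n ℕ.≤ toℕ r → 2 ℕ.* n ℕ.≤ toℕ s →
    IsEigenvector M (col (Vmat d A B) r ∘ᵥ col ((Vmat d A B) ⁽⁻⁾) s)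
lemma7p3 𝔽 n A B (((A⁻¹ , A⊗A⁻¹≈I , A⁻¹⊗A≈I) , B≉0 , jones , jonesᵀ) , A≉0 , (B⁻¹ , B⊗B⁻¹≈I , B⁻¹⊗B≈I))
  A-sym d d*d≈n M (F , G , H , _ , _ , _ , (T , S , PΘ , QΘ , _ , K , _ , ΘF , ΘF′ , ΘG , ΘGᵀ , _ , _ , _ , M≈))
  r s 2n≤r 2n≤s with lower-half {n} r 2n≤r | lower-half {n} s 2n≤s
... | c , i , ≡.refl | c′ , j , ≡.refl = lower-half-eigenvector d d≉0 ΘF ΘF′ ΘG ΘGᵀ M≈ c c′ i j
  where
  open ACF0 𝔽
  open FieldProperties 𝔽 using (fromℕ≉0)
  open JonesPairs.SymmetricJonesPair 𝔽 i A B A⁻¹ B⁻¹ A⊗A⁻¹≈I A⁻¹⊗A≈I B⊗B⁻¹≈I B⁻¹⊗B≈I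
                                     A≉0 B≉0 A-sym jones jonesᵀ
  d≉0 : d ≉ 0#
  d≉0 d≈0 = fromℕ≉0 i (trans (sym d*d≈n) (trans (*-congʳ d≈0) (zeroˡ d)))
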